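{- The linear span $\mathcal{E}(\mathbf H)$ of (isomorphism classes of) eulerian hypergraphs is a subalgebra of the odd subalgebra $S_-(\mathcal{H}(\mathbf H),\zeta_{\mathbf H})$. Moreover, for every eulerian hypergraph $H$ on an $n$-element vertex set $V$, every composition $(a_1,\dots,a_k)$ of $n$ and every $i\in\{1,\dots,k\}$, $\sum_{j=0}^{a_i}(-1)^j\,(\zeta_{\mathbf H})_{(a_1,\dots,a_{i-1},j,a_i-j,a_{i+1},\dots,a_k)}(H)=0.$
   Context: A hypergraph $H$ on a finite vertex set $V$ is a collection of subsets of $V$ (edges), each with at least two elements; it is discrete if it has no edges; $H_\emptyset$ is the hypergraph on the empty set. The restriction to $I\subseteq V$ is $H|_I=\{e\in H:e\subseteq I\}$ on vertex set $I$. $\mathcal{H}(\mathbf H)$ is the graded vector space over a field $\mathbf k$ spanned by isomorphism classes of finite hypergraphs, graded by number of vertices, with product the disjoint union $H_1\sqcup H_2$ (on $V(H_1)\sqcup V(H_2)$, edges those of $H_1$ and of $H_2$), coproduct $\Delta(H)=\sum_{I\subseteq V}H|_I\otimes H|_{V\setminus I}$, unit $H_\emptyset$, counit $\epsilon(H)=1$ if $H=H_\emptyset$ and $0$ otherwise; it is a graded connected Hopf algebra with antipode $S$. The character $\zeta_{\mathbf H}$ is the linear multiplicative functional with $\zeta_{\mathbf H}(H)=1$ if $H$ is discrete and $0$ otherwise. Its convolution inverse is $\zeta_{\mathbf H}^{ -1}=\zeta_{\mathbf H}\circ S$, and the conjugate character is $\overline{\zeta}_{\mathbf H}(H)=(-1)^{|V(H)|}\zeta_{\mathbf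 H}(H)$. The odd subalgebra $S_-(\mathcal{H}(\mathbf H),\zeta_{\mathbf H})$ is the largest graded Hopf subalgebra of $\mathcal{H}(\mathbf H)$ on which $\zeta_{\mathbf H}^{ -1}=\overline{\zeta}_{\mathbf H}$. The Euler character is $\chi_{\mathbf H}=\overline{\zeta}_{\mathbf H}\zeta_{\mathbf H}$ (convolution), i.e. $\chi_{\mathbf H}(H)=\sum_{I\subseteq V}(-1)^{|I|}\zeta_{\mathbf H}(H|_I)\zeta_{\mathbf H}(H|_{V\setminus I})$. A hypergraph $H$ is eulerian if $\chi_{\mathbf H}(H|_I)=\epsilon(H|_I)$ for all $I\subseteq V$. For a sequence $\beta=(b_1,\dots,b_m)$ of nonnegative integers summing to $|V|$, $(\zeta_{\mathbf H})_\beta(H)$ is the number of ordered decompositions $(I_1,\dots,I_m)$ of $V$ into pairwise disjoint (possibly empty) sets with $|I_j|=b_j$ and $H|_{I_j}$ discrete for all $j$. -}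

module Defs where

open import Level using (Level; _⊔_) renaming (suc to lsuc)
open import Data.Bool using (Bool; true; false; _∧_; _∨_; not; if_then_else_)
open import Data.Nat using (ℕ; zero; suc; _+_; _∸_; _≤_; z≤n; s≤s)
import Data.Nat
open import Data.Nat.Properties using (≤-trans; m≤m+n; +-identityʳ)
open import Data.Fin using (Fin; zero; suc)
import Data.Fin as Fin
open import Data.Fin.Permutation using (Permutation′; _⟨$⟩ˡ_)
open import Data.Vec using (Vec; []; _∷_; lookup; tabulate)
import Data.Vec as Vec
open import Data.List using (List; []; _∷_; [_]; map; _++_; concatMap; foldr; filterᵇ; upTo; allFin)
open import Data.Bool.ListAction using (and)
open import Data.List.Relation.Unary.All using (All)
open import Data.Sum using (_⊎_; inj₁; inj₂)
open import Data.Product using (Σ; _×_; _,_; proj₁; proj₂)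
open import Relation.Binary.PropositionalEquality using (_≡_; refl; subst; cong; sym; trans)
open import Relation.Nullary using (¬_; does)
open import Algebra.Bundles using (CommutativeRing)

record Field (c ℓ : Level) : Set (lsuc (c ⊔ ℓ)) where
  field
    commutativeRing : CommutativeRing c ℓ
  open CommutativeRing commutativeRing public
  field
    0≉1     : ¬ (0# ≈ 1#)
    inverse : ∀ x → ¬ (x ≈ 0#) → Σ Carrier λ y → x * y ≈ 1#

-- Subsets of the vertex set Fin n, as characteristic vectors

size : ∀ {n} → Vec Bool n → ℕ
size []          = 0
size (true  ∷ s) = suc (size s)
size (false ∷ s) = size s

allSubsets : (n : ℕ) → List (Vec Bool n)
allSubsets zero    = [ [] ]
allSubsets (suc n) = map (false ∷_) (allSubsets n) ++ map (true ∷_) (allSubsets n)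

∁ : ∀ {n} → Vec Bool n → Vec Bool n
∁ = Vec.map not

isEmptyᵇ : ∀ {n} → Vec Bool n → Bool
isEmptyᵇ []          = true
isEmptyᵇ (true  ∷ s) = false
isEmptyᵇ (false ∷ s) = isEmptyᵇ s

-- a subset of Fin (size I) pushed forward along the order-preserving
-- bijection Fin (size I) ≅ I ⊆ Fin n
push : ∀ {n} (I : Vec Bool n) → Vec Bool (size I) → Vec Bool n
push []          []      = []
push (true  ∷ I) (b ∷ e) = b ∷ push I e
push (false ∷ I) e       = false ∷ push I e

size-push : ∀ {n} (I : Vec Bool n) (e : Vec Bool (size I)) → size (push I e) ≡ size e
size-push []          []          = refl
size-push (true  ∷ I) (true  ∷ e) = cong suc (size-push I e)
size-push (true  ∷ I) (false ∷ e) = size-push I e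
size-push (false ∷ I) e           = size-push I e

splitV : ∀ {A : Set} n {m} → Vec A (n + m) → Vec A n × Vec A m
splitV zero    v       = [] , v
splitV (suc n) (x ∷ v) = (x ∷ proj₁ (splitV n v)) , proj₂ (splitV n v)

record Hyp (n : ℕ) : Set where
  field
    edge : Vec Bool n → Bool
    wf   : ∀ e → edge e ≡ true → 2 ≤ size e
open Hyp public

discrete : ∀ {n} → Hyp n → Bool
discrete {n} H = and (map (λ e → not (edge H e)) (allSubsets n))

-- restriction H|_I, relabelled to the vertex set Fin |I|
restrict : ∀ {n} → Hyp n → (I : Vec Bool n) → Hyp (size I)
restrict H I = record
  { edge = λ e → edge H (push I e)
  ; wf   = λ e p → subst (2 ≤_) (size-push I e) (wf H (push I e) p) }

∨-elim : ∀ {a b : Bool} → (a ∨ b) ≡ true → (a ≡ true) ⊎ (b ≡ true)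
∨-elim {true}  p = inj₁ refl
∨-elim {false} p = inj₂ p

∧-l : ∀ {a b : Bool} → (a ∧ b) ≡ true → a ≡ true
∧-l {true} p = refl

∧-r : ∀ {a b : Bool} → (a ∧ b) ≡ true → b ≡ true
∧-r {true} p = p

empty-size : ∀ {n} (s : Vec Bool n) → isEmptyᵇ s ≡ true → size s ≡ 0
empty-size []          p = refl
empty-size (false ∷ s) p = empty-size s p

size-split : ∀ n {m} (e : Vec Bool (n + m)) →
             size e ≡ size (proj₁ (splitV n e)) + size (proj₂ (splitV n e))
size-split zero    e           = refl
size-split (suc n) (true  ∷ e) = cong suc (size-split n e)
size-split (suc n) (false ∷ e) = size-split n e

⊔-wf : ∀ {n m} (G : Hyp n) (H : Hyp m) (e : Vec Bool (n + m)) →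
       ((edge G (proj₁ (splitV n e)) ∧ isEmptyᵇ (proj₂ (splitV n e)))
        ∨ (isEmptyᵇ (proj₁ (splitV n e)) ∧ edge H (proj₂ (splitV n e)))) ≡ true →
       2 ≤ size e
⊔-wf {n} G H e p with ∨-elim p
... | inj₁ q = subst (2 ≤_) (sym (trans (size-split n e)
                 (trans (cong (size (proj₁ (splitV n e)) +_)
                          (empty-size (proj₂ (splitV n e)) (∧-r q)))
                        (+-identityʳ _))))
                 (wf G _ (∧-l q))
... | inj₂ q = subst (2 ≤_) (sym (trans (size-split n e)
                 (cong (_+ size (proj₂ (splitV n e)))
                       (empty-size (proj₁ (splitV n e)) (∧-l q)))))
                 (wf H _ (∧-r q))

-- disjoint union: vertex set Fin (n + m) = Fin n ⊔ Fin m; the edges are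
-- those of G (on the first n vertices) and those of H (on the last m)
_⊔ₕ_ : ∀ {n m} → Hyp n → Hyp m → Hyp (n + m)
_⊔ₕ_ {n} G H = record
  { edge = λ e → (edge G (proj₁ (splitV n e)) ∧ isEmptyᵇ (proj₂ (splitV n e)))
                 ∨ (isEmptyᵇ (proj₁ (splitV n e)) ∧ edge H (proj₂ (splitV n e)))
  ; wf   = ⊔-wf G H }

H∅ : Hyp 0
H∅ = record { edge = λ _ → false ; wf = λ _ () }

image : ∀ {n} → Permutation′ n → Vec Bool n → Vec Bool n
image σ e = tabulate (λ j → lookup e (σ ⟨$⟩ˡ j))

_≅_ : ∀ {n} → Hyp n → Hyp n → Set
_≅_ {n} G H = Σ (Permutation′ n) λ σ → ∀ e → edge H (image σ e) ≡ edge G e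

-- Ordered decompositions (I_1,…,I_m) of Fin n into pairwise disjoint,
-- possibly empty, sets correspond to maps Fin n → Fin m (I_j = a⁻¹(j)).

allAssign : (m n : ℕ) → List (Vec (Fin m) n)
allAssign m zero    = [ [] ]
allAssign m (suc n) = concatMap (λ v → map (_∷ v) (allFin m)) (allAssign m n)

block : ∀ {m n} → Vec (Fin m) n → Fin m → Vec Bool n
block a j = Vec.map (λ x → does (x Fin.≟ j)) a

-- the sequence (a_1,…,a_{i-1}, j, a_i - j, a_{i+1},…,a_k)
splitEntry : ∀ {k} → Vec ℕ k → Fin k → ℕ → Vec ℕ (suc k)
splitEntry (x ∷ xs) zero    j = j ∷ (x ∸ j) ∷ xs
splitEntry (x ∷ xs) (suc i) j = x ∷ splitEntry xs i j

sumV : ∀ {k} → Vec ℕ k → ℕ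
sumV []       = 0
sumV (x ∷ xs) = x + sumV xs

module HopfAlg {c ℓ} (F : Field c ℓ) where
  open Field F public renaming (_+_ to _+ₖ_; _*_ to _*ₖ_)

  sgn : ℕ → Carrier
  sgn zero    = 1#
  sgn (suc j) = - sgn j

  Σ[_] : ∀ {a} {A : Set a} → List A → (A → Carrier) → Carrier
  Σ[ xs ] f = foldr (λ x r → f x +ₖ r) 0# xs

  Basis : Set
  Basis = Σ ℕ Hyp

  -- elements of 𝓗(𝐇): finite formal k-linear combinations of
  -- hypergraphs; two of them are identified (≋ below) when they agree
  -- as combinations of isomorphism classes.
  Elem : Set c
  Elem = List (Carrier × Basis)

  -- elements of 𝓗(𝐇) ⊗ 𝓗(𝐇)
  Elem₂ : Set c
  Elem₂ = List (Carrier × Basis × Basis)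

  Invariant : (Basis → Carrier) → Set ℓ
  Invariant f = ∀ n (G H : Hyp n) → G ≅ H → f (n , G) ≈ f (n , H)

  Invariant₂ : (Basis → Basis → Carrier) → Set ℓ
  Invariant₂ f = ∀ n (G H : Hyp n) m (G' H' : Hyp m) → G ≅ H → G' ≅ H' →
                 f (n , G) (m , G') ≈ f (n , H) (m , H')

  lin : (Basis → Carrier) → Elem → Carrier
  lin f x = Σ[ x ] (λ { (a , b) → a *ₖ f b })

  lin₂ : (Basis → Basis → Carrier) → Elem₂ → Carrier
  lin₂ f t = Σ[ t ] (λ { (a , b , b') → a *ₖ f b b' })

  -- equality in 𝓗(𝐇) (free k-module on isomorphism classes): all
  -- coordinates agree, i.e. all invariant linear functionals agree
  _≋_ : Elem → Elem → Set (c ⊔ ℓ)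
  x ≋ y = ∀ f → Invariant f → lin f x ≈ lin f y

  _≋₂_ : Elem₂ → Elem₂ → Set (c ⊔ ℓ)
  t ≋₂ u = ∀ f → Invariant₂ f → lin₂ f t ≈ lin₂ f u

  0ᴱ : Elem
  0ᴱ = []

  _+ᴱ_ : Elem → Elem → Elem
  _+ᴱ_ = _++_

  _·ᴱ_ : Carrier → Elem → Elem
  a ·ᴱ x = map (λ { (b , h) → (a *ₖ b , h) }) x

  _⊔ᴮ_ : Basis → Basis → Basis
  (n , G) ⊔ᴮ (m , H) = (n + m , G ⊔ₕ H)

  _*ᴱ_ : Elem → Elem → Elem
  x *ᴱ y = concatMap (λ { (a , g) → map (λ { (b , h) → (a *ₖ b , g ⊔ᴮ h) }) y }) x

  1ᴱ : Elem
  1ᴱ = [ (1# , (0 , H∅)) ]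

  Δᴮ : Basis → Elem₂
  Δᴮ (n , H) = map (λ I → (1# , (size I , restrict H I) , (size (∁ I) , restrict H (∁ I))))
                   (allSubsets n)

  Δᴱ : Elem → Elem₂
  Δᴱ x = concatMap (λ { (a , h) → map (λ { (b , u , v) → (a *ₖ b , u , v) }) (Δᴮ h) }) x

  _⊗ᴱ_ : Elem → Elem → Elem₂
  x ⊗ᴱ y = concatMap (λ { (a , g) → map (λ { (b , h) → (a *ₖ b , g , h) }) y }) x

  component : ℕ → Elem → Elem
  component d = filterᵇ (λ { (_ , (n , _)) → does (n Data.Nat.≟ d) })

  -- antipode, by Takeuchi's formula:
  -- S(H) = Σ_k (-1)^k Σ_{(I_1,…,I_k)} H|_{I_1} ⊔ ⋯ ⊔ H|_{I_k},
  -- over ordered decompositions of V into k nonempty blocks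
  prodᴮ : List Basis → Basis
  prodᴮ = foldr _⊔ᴮ_ (0 , H∅)

  Sᴮ : Basis → Elem
  Sᴮ (n , H) =
    concatMap (λ k →
      map (λ a → (sgn k , prodᴮ (map (λ j → (size (block a j) , restrict H (block a j)))
                                       (allFin k))))
          (filterᵇ (λ a → and (map (λ j → not (isEmptyᵇ (block a j))) (allFin k)))
                   (allAssign k n)))
      (upTo (suc n))

  Sᴱ : Elem → Elem
  Sᴱ x = concatMap (λ { (a , h) → a ·ᴱ Sᴮ h }) x

  ζ : Basis → Carrier
  ζ (n , H) = if discrete H then 1# else 0#

  ζ̄ : Basis → Carrier
  ζ̄ (n , H) = sgn n *ₖ ζ (n , H)

  ε : Basis → Carrier
  ε (zero  , H) = 1#
  ε (suc n , H) = 0#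

  ζᴱ ζ̄ᴱ : Elem → Carrier
  ζᴱ = lin ζ
  ζ̄ᴱ = lin ζ̄

  ζ⁻¹ᴱ : Elem → Carrier
  ζ⁻¹ᴱ x = ζᴱ (Sᴱ x)

  -- Euler character χ = ζ̄ ζ
  χ : Basis → Carrier
  χ (n , H) = Σ[ allSubsets n ] (λ I →
                sgn (size I) *ₖ ζ (size I , restrict H I) *ₖ ζ (size (∁ I) , restrict H (∁ I)))

  Eulerian : ∀ {n} → Hyp n → Set ℓ
  Eulerian {n} H = ∀ (I : Vec Bool n) →
                   χ (size I , restrict H I) ≈ ε (size I , restrict H I)

  -- (ζ)_β(H) for β = (b_1,…,b_m): number (in k) of ordered decompositions
  -- (I_1,…,I_m) of V with |I_j| = b_j and H|_{I_j} discrete for all j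
  ζseq : ∀ {m} → Vec ℕ m → Basis → Carrier
  ζseq {m} β (n , H) =
    Σ[ allAssign m n ] (λ a →
      if and (map (λ j → does (size (block a j) Data.Nat.≟ lookup β j)
                          ∧ discrete (restrict H (block a j)))
                  (allFin m))
      then 1# else 0#)

  -- graded Hopf subalgebras (given as ≋-closed predicates on 𝓗(𝐇))
  record IsGradedHopfSubalgebra (W : Elem → Set (c ⊔ ℓ)) : Set (c ⊔ ℓ) where
    field
      resp      : ∀ {x y} → x ≋ y → W x → W y
      zero-∈    : W 0ᴱ
      +-closed  : ∀ {x y} → W x → W y → W (x +ᴱ y)
      ·-closed  : ∀ a {x} → W x → W (a ·ᴱ x)
      unit-∈    : W 1ᴱ
      *-closed  : ∀ {x y} → W x → W y → W (x *ᴱ y)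
      graded    : ∀ {x} → W x → ∀ d → W (component d x)
      Δ-closed  : ∀ {x} → W x → Σ (List (Elem × Elem)) λ ps →
                    All (λ p → W (proj₁ p) × W (proj₂ p)) ps ×
                    Δᴱ x ≋₂ concatMap (λ p → proj₁ p ⊗ᴱ proj₂ p) ps
      S-closed  : ∀ {x} → W x → W (Sᴱ x)

  -- membership in the odd subalgebra S₋(𝓗(𝐇), ζ): the largest graded
  -- Hopf subalgebra on which ζ⁻¹ = ζ̄, i.e. the union of all such
  InOdd : Elem → Set (lsuc (c ⊔ ℓ))
  InOdd x = Σ (Elem → Set (c ⊔ ℓ)) λ W →
              IsGradedHopfSubalgebra W × (∀ y → W y → ζ⁻¹ᴱ y ≈ ζ̄ᴱ y) × W x

  InE : Elem → Set (c ⊔ ℓ)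
  InE x = Σ Elem λ y → All (λ p → Eulerian (proj₂ (proj₂ p))) y × x ≋ y

  record IsSubalgebra (W : Elem → Set (c ⊔ ℓ)) : Set (c ⊔ ℓ) where
    field
      resp      : ∀ {x y} → x ≋ y → W x → W y
      zero-∈    : W 0ᴱ
      +-closed  : ∀ {x y} → W x → W y → W (x +ᴱ y)
      ·-closed  : ∀ a {x} → W x → W (a ·ᴱ x)
      unit-∈    : W 1ᴱ
      *-closed  : ∀ {x y} → W x → W y → W (x *ᴱ y)

{-# OPTIONS --safe #-}
module Submission where

-- Restriction and disjoint union preserve eulerianness: χ of a restriction can be computed inside the ambient
-- hypergraph, and χ is multiplicative on disjoint unions.  Takeuchi's formula writes S(H) as a signed sum of
-- disjoint unions of restrictions of H, so the span of eulerian hypergraphs is a graded Hopf subalgebra.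
-- Takeuchi's formula also gives ζ(S(H)) = Σₖ (-1)ᵏ pₖ(H), where pₖ(H) counts the ordered partitions of V into
-- k nonempty independent blocks.  Adjoining a first, possibly empty, block gives ζ ⋆ pₖ = pₖ + pₖ₊₁, so
-- ζ ⋆ (ζ ∘ S) telescopes to ε; comparing with χ = ζ̄ ⋆ ζ = ε by induction on |V| gives ζ ∘ S = ζ̄ on eulerian
-- hypergraphs.
-- For the Dehn–Sommerville relations, split block i of each decomposition into T and C ∖ T: the alternating sum
-- over j = |T| leaves Σ_{T ⊆ C} (-1)^|T| ζ(H|_T) ζ(H|_{C∖T}) = χ(H|_C) = ε(H|_C), which vanishes as |C| = aᵢ ≥ 1.

open import Defs
open import Data.Nat using (ℕ; suc; _≤_)
open import Data.Fin using (Fin)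
open import Data.Vec using (Vec; lookup)
open import Data.List using (upTo)
open import Data.Product using (_×_; _,_)
open import Relation.Binary.PropositionalEquality using (_≡_)

open import Level using (_⊔_)
open import Data.Bool using (Bool; true; false; _∧_; _∨_; not; if_then_else_)
import Data.Bool.Properties as Boolₚ
open import Data.Bool.ListAction using (and)
open import Data.Nat using (zero; _+_; _∸_; _<_; z≤n; s≤s)
import Data.Nat as ℕ
import Data.Nat.Properties as ℕₚ
open import Data.Nat.Induction using (<-rec)
open import Data.Fin using (zero; suc; inject₁; punchIn; punchOut; splitAt; join; _↑ˡ_; _↑ʳ_)
import Data.Fin as Fin
import Data.Fin.Properties as Finₚ
open import Data.Fin.Permutation using (Permutation; permutation; _⟨$⟩ˡ_; _⟨$⟩ʳ_; inverseˡ; inverseʳ; ↔⇒≡)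
import Data.Fin.Permutation as Perm
open import Data.Vec using ([]; _∷_; tabulate; replicate) renaming (_++_ to _++ᵥ_)
import Data.Vec as Vec
import Data.Vec.Properties as Vecₚ
open import Data.List using (List; []; _∷_; [_]; map; _++_; concatMap; filterᵇ; allFin; applyUpTo)
import Data.List.Properties as Listₚ
open import Data.List.Membership.Propositional using (_∈_; _∉_)
open import Data.List.Membership.Propositional.Properties
  using (∈-map⁺; ∈-map⁻; ∈-++⁺ˡ; ∈-++⁺ʳ; ∈-++⁻; ∈-insert; ∈-∃++; ∈-concatMap⁺; ∈-concatMap⁻; ∈-allFin; ∈-applyUpTo⁻; ∈-upTo⁺; ∈-upTo⁻)
open import Data.List.Relation.Unary.Any using (Any; here; there)
import Data.List.Relation.Unary.Any as Any
open import Data.List.Relation.Unary.All using (All; []; _∷_)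
import Data.List.Relation.Unary.All as All
import Data.List.Relation.Unary.All.Properties as Allₚ
open import Data.List.Relation.Unary.AllPairs using ([]; _∷_)
open import Data.List.Relation.Unary.Unique.Propositional using (Unique)
import Data.List.Relation.Unary.Unique.Propositional.Properties as Uniqueₚ
open import Data.Product using (Σ; proj₁; proj₂)
open import Data.Sum using (_⊎_; inj₁; inj₂)
import Data.Sum as Sum
open import Data.Empty using (⊥; ⊥-elim)
open import Function using (_∘_; id)
open import Relation.Nullary using (does; yes; no; Dec; _because_)
open import Relation.Nullary.Decidable using (dec-true; dec-false; T?)
open import Relation.Nullary.Reflects using (invert)
import Relation.Binary.PropositionalEquality as ≡
open ≡ using (_≢_)

true≢false : true ≢ false
true≢false ()

bool-cases : ∀ b → (b ≡ true) ⊎ (b ≡ false)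
bool-cases true  = inj₁ ≡.refl
bool-cases false = inj₂ ≡.refl

bool-ext : ∀ {a b} → (a ≡ true → b ≡ true) → (b ≡ true → a ≡ true) → a ≡ b
bool-ext {true}  {true}  _   _   = ≡.refl
bool-ext {false} {false} _   _   = ≡.refl
bool-ext {true}  {false} a⇒b _   = ⊥-elim (true≢false (≡.sym (a⇒b ≡.refl)))
bool-ext {false} {true}  _   b⇒a = ⊥-elim (true≢false (≡.sym (b⇒a ≡.refl)))

not≡true⁺ : ∀ {a} → a ≡ false → not a ≡ true
not≡true⁺ ≡.refl = ≡.refl

not≡true⁻ : ∀ {a} → not a ≡ true → a ≡ false
not≡true⁻ {false} _ = ≡.refl

∧-intro : ∀ {a b} → a ≡ true → b ≡ true → (a ∧ b) ≡ true
∧-intro ≡.refl ≡.refl = ≡.refl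

dec-true⁻ : ∀ {p} {P : Set p} (p? : Dec P) → does p? ≡ true → P
dec-true⁻ (true because [p]) _ = invert [p]

and-map⁺ : ∀ {A : Set} (f : A → Bool) xs → (∀ x → x ∈ xs → f x ≡ true) → and (map f xs) ≡ true
and-map⁺ f []       _ = ≡.refl
and-map⁺ f (y ∷ xs) h = ∧-intro (h y (here ≡.refl)) (and-map⁺ f xs (λ x x∈ → h x (there x∈)))

and-map⁻ : ∀ {A : Set} (f : A → Bool) xs → and (map f xs) ≡ true → ∀ x → x ∈ xs → f x ≡ true
and-map⁻ f (y ∷ xs) p x (here ≡.refl) = ∧-l p
and-map⁻ f (y ∷ xs) p x (there x∈)    = and-map⁻ f xs (∧-r {f y} p) x x∈

and-allFin⁺ : ∀ {k} (f : Fin k → Bool) → (∀ j → f j ≡ true) → and (map f (allFin k)) ≡ true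
and-allFin⁺ {k} f h = and-map⁺ f (allFin k) (λ j _ → h j)

and-allFin⁻ : ∀ {k} (f : Fin k → Bool) → and (map f (allFin k)) ≡ true → ∀ j → f j ≡ true
and-allFin⁻ {k} f p j = and-map⁻ f (allFin k) p j (∈-allFin j)

and-allFin-suc : ∀ {k} (f : Fin (suc k) → Bool) →
                 and (map f (allFin (suc k))) ≡ f zero ∧ and (map (f ∘ suc) (allFin k))
and-allFin-suc {k} f = ≡.cong (λ xs → f zero ∧ and xs)
  (≡.trans (Listₚ.map-tabulate suc f) (≡.sym (Listₚ.map-tabulate id (f ∘ suc))))

≟-∸ : ∀ {t A} s → t ≤ A → does (s ℕ.≟ A ∸ t) ≡ does (t + s ℕ.≟ A)
≟-∸ {t} {A} s t≤A = bool-ext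
  (λ p → dec-true (t + s ℕ.≟ A) (≡.trans (≡.cong (t +_) (dec-true⁻ (s ℕ.≟ A ∸ t) p)) (ℕₚ.m+[n∸m]≡n t≤A)))
  (λ p → dec-true (s ℕ.≟ A ∸ t) (≡.trans (≡.sym (ℕₚ.m+n∸m≡n t s)) (≡.cong (_∸ t) (dec-true⁻ (t + s ℕ.≟ A) p))))

∈-insert⁻ : ∀ {A : Set} (ys₁ : List A) {x ys₂ y} → y ∈ ys₁ ++ x ∷ ys₂ → (y ≡ x) ⊎ (y ∈ ys₁ ++ ys₂)
∈-insert⁻ ys₁ y∈ with ∈-++⁻ ys₁ y∈
... | inj₁ y∈₁         = inj₂ (∈-++⁺ˡ y∈₁)
... | inj₂ (here y≡x)  = inj₁ y≡x
... | inj₂ (there y∈₂) = inj₂ (∈-++⁺ʳ ys₁ y∈₂)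

∈-insert⁺ : ∀ {A : Set} (ys₁ : List A) {x ys₂ y} → y ∈ ys₁ ++ ys₂ → y ∈ ys₁ ++ x ∷ ys₂
∈-insert⁺ ys₁ y∈ with ∈-++⁻ ys₁ y∈
... | inj₁ y∈₁ = ∈-++⁺ˡ y∈₁
... | inj₂ y∈₂ = ∈-++⁺ʳ ys₁ (there y∈₂)

Unique-insert⁻ : ∀ {A : Set} (ys₁ : List A) {x ys₂} → Unique (ys₁ ++ x ∷ ys₂) → Unique (ys₁ ++ ys₂) × x ∉ ys₁ ++ ys₂
Unique-insert⁻ []        (x∉ ∷ !ys) = !ys , λ x∈ → All.lookup x∉ x∈ ≡.refl
Unique-insert⁻ (y ∷ ys₁) {x} {ys₂} (y∉ ∷ !ys) with Unique-insert⁻ ys₁ !ys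
... | !ys′ , x∉ = All.tabulate (λ z∈ → All.lookup y∉ (∈-insert⁺ ys₁ z∈)) ∷ !ys′ , x∉′
  where
  x∉′ : x ∉ y ∷ (ys₁ ++ ys₂)
  x∉′ (here x≡y)  = All.lookup y∉ (∈-insert ys₁) (≡.sym x≡y)
  x∉′ (there x∈) = x∉ x∈

All-concatMap⁺ : ∀ {a b p q} {A : Set a} {B : Set b} {P : A → Set p} {Q : B → Set q} (f : A → List B) {xs} →
                 All P xs → (∀ x → P x → All Q (f x)) → All Q (concatMap f xs)
All-concatMap⁺ f ps h = Allₚ.concat⁺ (Allₚ.map⁺ (All.map (λ {x} → h x) ps))

Unique-concatMap : ∀ {A B : Set} (f : A → List B) {xs} → Unique xs → (∀ x → Unique (f x)) →
                   (∀ x y {z} → z ∈ f x → z ∈ f y → x ≡ y) → Unique (concatMap f xs)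
Unique-concatMap f {[]}     []         _  _    = []
Unique-concatMap f {x ∷ xs} (x∉ ∷ !xs) !f disj = Uniqueₚ.++⁺ (!f x) (Unique-concatMap f !xs !f disj) apart
  where
  apart : ∀ {z} → z ∈ f x × z ∈ concatMap f xs → ⊥
  apart (z∈fx , z∈rest) = go x∉ (∈-concatMap⁻ f z∈rest)
    where
    go : ∀ {ys} → All (x ≢_) ys → Any (λ y → _ ∈ f y) ys → ⊥
    go (x≢y ∷ _)   (here z∈fy) = x≢y (disj _ _ z∈fx z∈fy)
    go (_   ∷ x≢s) (there any) = go x≢s any

lookup-ext : ∀ {A : Set} {n} {u v : Vec A n} → (∀ i → lookup u i ≡ lookup v i) → u ≡ v
lookup-ext {u = u} {v} p =
  ≡.trans (≡.sym (Vecₚ.tabulate∘lookup u)) (≡.trans (Vecₚ.tabulate-cong p) (Vecₚ.tabulate∘lookup v))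

∈-allSubsets : ∀ {n} (e : Vec Bool n) → e ∈ allSubsets n
∈-allSubsets []                = here ≡.refl
∈-allSubsets {suc n} (false ∷ e) = ∈-++⁺ˡ (∈-map⁺ (false ∷_) (∈-allSubsets e))
∈-allSubsets {suc n} (true ∷ e)  = ∈-++⁺ʳ (map (false ∷_) (allSubsets n)) (∈-map⁺ (true ∷_) (∈-allSubsets e))

∈-allAssign : ∀ {m n} (a : Vec (Fin m) n) → a ∈ allAssign m n
∈-allAssign []                  = here ≡.refl
∈-allAssign {m} {suc n} (x ∷ a) =
  ∈-concatMap⁺ (λ v → map (_∷ v) (allFin m)) (Any.map (λ { ≡.refl → ∈-map⁺ (_∷ a) (∈-allFin x) }) (∈-allAssign a))

Unique-allSubsets : ∀ n → Unique (allSubsets n)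
Unique-allSubsets zero    = [] ∷ []
Unique-allSubsets (suc n) =
  Uniqueₚ.++⁺ (Uniqueₚ.map⁺ Vecₚ.∷-injectiveʳ (Unique-allSubsets n)) (Uniqueₚ.map⁺ Vecₚ.∷-injectiveʳ (Unique-allSubsets n)) apart
  where
  apart : ∀ {v} → v ∈ map (false ∷_) (allSubsets n) × v ∈ map (true ∷_) (allSubsets n) → ⊥
  apart (v∈₀ , v∈₁) with ∈-map⁻ (false ∷_) v∈₀ | ∈-map⁻ (true ∷_) v∈₁
  ... | _ , _ , ≡.refl | _ , _ , ()

Unique-allAssign : ∀ m n → Unique (allAssign m n)
Unique-allAssign m zero    = [] ∷ []
Unique-allAssign m (suc n) =
  Unique-concatMap (λ v → map (_∷ v) (allFin m)) (Unique-allAssign m n)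
    (λ v → Uniqueₚ.map⁺ Vecₚ.∷-injectiveˡ (Uniqueₚ.allFin⁺ m)) tails-agree
  where
  tails-agree : ∀ u v {z} → z ∈ map (_∷ u) (allFin m) → z ∈ map (_∷ v) (allFin m) → u ≡ v
  tails-agree u v z∈u z∈v with ∈-map⁻ (_∷ u) z∈u | ∈-map⁻ (_∷ v) z∈v
  ... | _ , _ , ≡.refl | _ , _ , eq = Vecₚ.∷-injectiveʳ eq

∅ : ∀ n → Vec Bool n
∅ n = replicate n false

full : ∀ n → Vec Bool n
full n = ∁ (∅ n)

nonemptySubsets : ∀ n → List (Vec Bool n)
nonemptySubsets zero    = []
nonemptySubsets (suc n) = map (false ∷_) (nonemptySubsets n) ++ map (true ∷_) (allSubsets n)

allSubsets≡∅∷nonemptySubsets : ∀ n → allSubsets n ≡ ∅ n ∷ nonemptySubsets n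
allSubsets≡∅∷nonemptySubsets zero    = ≡.refl
allSubsets≡∅∷nonemptySubsets (suc n) =
  ≡.cong (λ xs → map (false ∷_) xs ++ map (true ∷_) (allSubsets n)) (allSubsets≡∅∷nonemptySubsets n)

All-nonempty-nonemptySubsets : ∀ n → All (λ I → isEmptyᵇ I ≡ false) (nonemptySubsets n)
All-nonempty-nonemptySubsets zero    = []
All-nonempty-nonemptySubsets (suc n) =
  Allₚ.++⁺ (Allₚ.map⁺ (All-nonempty-nonemptySubsets n)) (Allₚ.map⁺ (All.universal (λ _ → ≡.refl) (allSubsets n)))

lookup-∁ : ∀ {n} (I : Vec Bool n) i → lookup (∁ I) i ≡ not (lookup I i)
lookup-∁ I i = Vecₚ.lookup-map i not I

∁-involutive : ∀ {n} (I : Vec Bool n) → ∁ (∁ I) ≡ I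
∁-involutive I = lookup-ext (λ i →
  ≡.trans (lookup-∁ (∁ I) i) (≡.trans (≡.cong not (lookup-∁ I i)) (Boolₚ.not-involutive (lookup I i))))

isEmpty⁺ : ∀ {n} (v : Vec Bool n) → (∀ i → lookup v i ≡ false) → isEmptyᵇ v ≡ true
isEmpty⁺ []          _ = ≡.refl
isEmpty⁺ (true ∷ v)  h = ≡.sym (h zero)
isEmpty⁺ (false ∷ v) h = isEmpty⁺ v (h ∘ suc)

isEmpty⁻ : ∀ {n} (v : Vec Bool n) → isEmptyᵇ v ≡ true → ∀ i → lookup v i ≡ false
isEmpty⁻ (false ∷ v) _ zero    = ≡.refl
isEmpty⁻ (false ∷ v) p (suc i) = isEmpty⁻ v p i

isEmpty-∅ : ∀ n → isEmptyᵇ (∅ n) ≡ true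
isEmpty-∅ zero    = ≡.refl
isEmpty-∅ (suc n) = isEmpty-∅ n

lookup-full : ∀ n i → lookup (full n) i ≡ true
lookup-full (suc n) zero    = ≡.refl
lookup-full (suc n) (suc i) = lookup-full n i

size-full : ∀ n → size (full n) ≡ n
size-full zero    = ≡.refl
size-full (suc n) = ≡.cong suc (size-full n)

size-∁ : ∀ {n} (I : Vec Bool n) → size I + size (∁ I) ≡ n
size-∁ []                  = ≡.refl
size-∁ (true ∷ I)          = ≡.cong suc (size-∁ I)
size-∁ {suc n} (false ∷ I) = ≡.trans (ℕₚ.+-suc (size I) (size (∁ I))) (≡.cong suc (size-∁ I))

size≤ : ∀ {n} (I : Vec Bool n) → size I ≤ n
size≤ []          = z≤n
size≤ (true ∷ I)  = s≤s (size≤ I)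
size≤ (false ∷ I) = ℕₚ.m≤n⇒m≤1+n (size≤ I)

nonempty⇒size>0 : ∀ {n} (I : Vec Bool n) → isEmptyᵇ I ≡ false → 0 < size I
nonempty⇒size>0 (true ∷ I)  _ = s≤s z≤n
nonempty⇒size>0 (false ∷ I) p = nonempty⇒size>0 I p

nonempty⇒size-∁< : ∀ {n} (I : Vec Bool n) → isEmptyᵇ I ≡ false → size (∁ I) < n
nonempty⇒size-∁< I p = ≡.subst (size (∁ I) <_) (size-∁ I) (ℕₚ.+-monoˡ-≤ (size (∁ I)) (nonempty⇒size>0 I p))

nonempty⇒∈ : ∀ {n} (v : Vec Bool n) → isEmptyᵇ v ≡ false → Σ (Fin n) λ i → lookup v i ≡ true
nonempty⇒∈ (true ∷ v)  _ = zero , ≡.refl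
nonempty⇒∈ (false ∷ v) p with nonempty⇒∈ v p
... | i , v[i] = suc i , v[i]

size-++ : ∀ {n m} (u : Vec Bool n) (v : Vec Bool m) → size (u ++ᵥ v) ≡ size u + size v
size-++ []          v = ≡.refl
size-++ (true ∷ u)  v = ≡.cong suc (size-++ u v)
size-++ (false ∷ u) v = size-++ u v

full-++ : ∀ n {m} → full (n + m) ≡ full n ++ᵥ full m
full-++ zero    = ≡.refl
full-++ (suc n) = ≡.cong (true ∷_) (full-++ n)

splitV-++ : ∀ {A : Set} {n m} (u : Vec A n) (v : Vec A m) → splitV n (u ++ᵥ v) ≡ (u , v)
splitV-++ []      v = ≡.refl
splitV-++ (x ∷ u) v = ≡.cong (λ s → (x ∷ proj₁ s) , proj₂ s) (splitV-++ u v)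

++-splitV : ∀ {A : Set} n {m} (e : Vec A (n + m)) → proj₁ (splitV n e) ++ᵥ proj₂ (splitV n e) ≡ e
++-splitV zero    e       = ≡.refl
++-splitV (suc n) (x ∷ e) = ≡.cong (x ∷_) (++-splitV n e)

lookup-splitV₁ : ∀ {A : Set} n {m} (v : Vec A (n + m)) i → lookup (proj₁ (splitV n v)) i ≡ lookup v (i ↑ˡ m)
lookup-splitV₁ (suc n) (x ∷ v) zero    = ≡.refl
lookup-splitV₁ (suc n) (x ∷ v) (suc i) = lookup-splitV₁ n v i

lookup-splitV₂ : ∀ {A : Set} n {m} (v : Vec A (n + m)) i → lookup (proj₂ (splitV n v)) i ≡ lookup v (n ↑ʳ i)
lookup-splitV₂ zero    v       i = ≡.refl
lookup-splitV₂ (suc n) (x ∷ v) i = lookup-splitV₂ n v i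

_⊆_ : ∀ {n} → Vec Bool n → Vec Bool n → Set
T ⊆ X = ∀ i → lookup T i ≡ true → lookup X i ≡ true

⊆-trans : ∀ {n} {A B C : Vec Bool n} → A ⊆ B → B ⊆ C → A ⊆ C
⊆-trans A⊆B B⊆C i p = B⊆C i (A⊆B i p)

∅-⊆ : ∀ {n} (T : Vec Bool n) → ∅ n ⊆ T
∅-⊆ (t ∷ T) zero    ()
∅-⊆ (t ∷ T) (suc i) p = ∅-⊆ T i p

++-⊆⁺ : ∀ {n m} {e₁ T₁ : Vec Bool n} {e₂ T₂ : Vec Bool m} → e₁ ⊆ T₁ → e₂ ⊆ T₂ → (e₁ ++ᵥ e₂) ⊆ (T₁ ++ᵥ T₂)
++-⊆⁺ {e₁ = []}     {[]}     _  s₂ = s₂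
++-⊆⁺ {e₁ = _ ∷ e₁} {_ ∷ T₁} s₁ s₂ zero    p = s₁ zero p
++-⊆⁺ {e₁ = _ ∷ e₁} {_ ∷ T₁} s₁ s₂ (suc i) p = ++-⊆⁺ {e₁ = e₁} {T₁} (s₁ ∘ suc) s₂ i p

++-⊆⁻ˡ : ∀ {n m} {e₁ T₁ : Vec Bool n} {e₂ T₂ : Vec Bool m} → (e₁ ++ᵥ e₂) ⊆ (T₁ ++ᵥ T₂) → e₁ ⊆ T₁
++-⊆⁻ˡ {e₁ = _ ∷ e₁} {_ ∷ T₁} s zero    p = s zero p
++-⊆⁻ˡ {e₁ = _ ∷ e₁} {_ ∷ T₁} s (suc i) p = ++-⊆⁻ˡ {e₁ = e₁} {T₁} (s ∘ suc) i p

++-⊆⁻ʳ : ∀ {n m} {e₁ T₁ : Vec Bool n} {e₂ T₂ : Vec Bool m} → (e₁ ++ᵥ e₂) ⊆ (T₁ ++ᵥ T₂) → e₂ ⊆ T₂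
++-⊆⁻ʳ {e₁ = []}     {[]}     s = s
++-⊆⁻ʳ {e₁ = _ ∷ e₁} {_ ∷ T₁} s = ++-⊆⁻ʳ {e₁ = e₁} {T₁} (s ∘ suc)

_⊆ᵇ_ : ∀ {n} → Vec Bool n → Vec Bool n → Bool
[]      ⊆ᵇ []      = true
(t ∷ T) ⊆ᵇ (x ∷ X) = (not t ∨ x) ∧ (T ⊆ᵇ X)

⊆ᵇ⇒⊆ : ∀ {n} (T X : Vec Bool n) → (T ⊆ᵇ X) ≡ true → T ⊆ X
⊆ᵇ⇒⊆ (true ∷ T) (x ∷ X) p zero    _ = ∧-l p
⊆ᵇ⇒⊆ (t ∷ T)    (x ∷ X) p (suc i) q = ⊆ᵇ⇒⊆ T X (∧-r {not t ∨ x} p) i q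

⊆ᵇ-full : ∀ {n} (T : Vec Bool n) → (T ⊆ᵇ full n) ≡ true
⊆ᵇ-full []          = ≡.refl
⊆ᵇ-full (true ∷ T)  = ⊆ᵇ-full T
⊆ᵇ-full (false ∷ T) = ⊆ᵇ-full T

⊆ᵇ-++ : ∀ {n m} (T₁ X₁ : Vec Bool n) (T₂ X₂ : Vec Bool m) →
        ((T₁ ++ᵥ T₂) ⊆ᵇ (X₁ ++ᵥ X₂)) ≡ (T₁ ⊆ᵇ X₁) ∧ (T₂ ⊆ᵇ X₂)
⊆ᵇ-++ []       []       T₂ X₂ = ≡.refl
⊆ᵇ-++ (t ∷ T₁) (x ∷ X₁) T₂ X₂ =
  ≡.trans (≡.cong ((not t ∨ x) ∧_) (⊆ᵇ-++ T₁ X₁ T₂ X₂)) (≡.sym (Boolₚ.∧-assoc (not t ∨ x) _ _))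

_∖_ : ∀ {n} → Vec Bool n → Vec Bool n → Vec Bool n
[]      ∖ []      = []
(x ∷ X) ∖ (t ∷ T) = (x ∧ not t) ∷ (X ∖ T)

lookup-∖ : ∀ {n} (X T : Vec Bool n) i → lookup (X ∖ T) i ≡ lookup X i ∧ not (lookup T i)
lookup-∖ (x ∷ X) (t ∷ T) zero    = ≡.refl
lookup-∖ (x ∷ X) (t ∷ T) (suc i) = lookup-∖ X T i

full-∖ : ∀ {n} (T : Vec Bool n) → full n ∖ T ≡ ∁ T
full-∖ []      = ≡.refl
full-∖ (t ∷ T) = ≡.cong (not t ∷_) (full-∖ T)

∖-++ : ∀ {n m} (X₁ T₁ : Vec Bool n) (X₂ T₂ : Vec Bool m) → (X₁ ++ᵥ X₂) ∖ (T₁ ++ᵥ T₂) ≡ (X₁ ∖ T₁) ++ᵥ (X₂ ∖ T₂)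
∖-++ []       []       X₂ T₂ = ≡.refl
∖-++ (x ∷ X₁) (t ∷ T₁) X₂ T₂ = ≡.cong ((x ∧ not t) ∷_) (∖-++ X₁ T₁ X₂ T₂)

size-∖ : ∀ {n} (T X : Vec Bool n) → (T ⊆ᵇ X) ≡ true → size T + size (X ∖ T) ≡ size X
size-∖ []          []          _ = ≡.refl
size-∖ (true ∷ T)  (true ∷ X)  p = ≡.cong suc (size-∖ T X p)
size-∖ (false ∷ T) (true ∷ X)  p = ≡.trans (ℕₚ.+-suc (size T) _) (≡.cong suc (size-∖ T X p))
size-∖ (false ∷ T) (false ∷ X) p = size-∖ T X p

embed : ∀ {n} (I : Vec Bool n) → Fin (size I) → Fin n
embed (true ∷ I)  zero    = zero
embed (true ∷ I)  (suc k) = suc (embed I k)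
embed (false ∷ I) k       = suc (embed I k)

rank : ∀ {n} (I : Vec Bool n) (v : Fin n) → lookup I v ≡ true → Fin (size I)
rank (true ∷ I)  zero    _ = zero
rank (true ∷ I)  (suc v) p = suc (rank I v p)
rank (false ∷ I) (suc v) p = rank I v p

embed-∈ : ∀ {n} (I : Vec Bool n) k → lookup I (embed I k) ≡ true
embed-∈ (true ∷ I)  zero    = ≡.refl
embed-∈ (true ∷ I)  (suc k) = embed-∈ I k
embed-∈ (false ∷ I) k       = embed-∈ I k

rank-embed : ∀ {n} (I : Vec Bool n) k p → rank I (embed I k) p ≡ k
rank-embed (true ∷ I)  zero    _ = ≡.refl
rank-embed (true ∷ I)  (suc k) p = ≡.cong suc (rank-embed I k p)
rank-embed (false ∷ I) k       p = rank-embed I k p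

embed-rank : ∀ {n} (I : Vec Bool n) v p → embed I (rank I v p) ≡ v
embed-rank (true ∷ I)  zero    _ = ≡.refl
embed-rank (true ∷ I)  (suc v) p = ≡.cong suc (embed-rank I v p)
embed-rank (false ∷ I) (suc v) p = ≡.cong suc (embed-rank I v p)

rank-cong : ∀ {n} (I : Vec Bool n) {v w} → v ≡ w → ∀ p q → rank I v p ≡ rank I w q
rank-cong (true ∷ I)  {zero}  ≡.refl _ _ = ≡.refl
rank-cong (true ∷ I)  {suc v} ≡.refl p q = ≡.cong suc (rank-cong I ≡.refl p q)
rank-cong (false ∷ I) {suc v} ≡.refl p q = rank-cong I ≡.refl p q

lookup-push-∈ : ∀ {n} (I : Vec Bool n) e v p → lookup (push I e) v ≡ lookup e (rank I v p)
lookup-push-∈ (true ∷ I)  (b ∷ e) zero    _ = ≡.refl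
lookup-push-∈ (true ∷ I)  (b ∷ e) (suc v) p = lookup-push-∈ I e v p
lookup-push-∈ (false ∷ I) e       (suc v) p = lookup-push-∈ I e v p

lookup-push-∉ : ∀ {n} (I : Vec Bool n) e v → lookup I v ≡ false → lookup (push I e) v ≡ false
lookup-push-∉ (true ∷ I)  (b ∷ e) (suc v) p = lookup-push-∉ I e v p
lookup-push-∉ (false ∷ I) e       zero    _ = ≡.refl
lookup-push-∉ (false ∷ I) e       (suc v) p = lookup-push-∉ I e v p

pull : ∀ {n} (I : Vec Bool n) → Vec Bool n → Vec Bool (size I)
pull []          []      = []
pull (true ∷ I)  (b ∷ e) = b ∷ pull I e
pull (false ∷ I) (b ∷ e) = pull I e

lookup-pull : ∀ {n} (I : Vec Bool n) e k → lookup (pull I e) k ≡ lookup e (embed I k)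
lookup-pull (true ∷ I)  (b ∷ e) zero    = ≡.refl
lookup-pull (true ∷ I)  (b ∷ e) (suc k) = lookup-pull I e k
lookup-pull (false ∷ I) (b ∷ e) k       = lookup-pull I e k

push-pull : ∀ {n} (I e : Vec Bool n) → e ⊆ I → push I (pull I e) ≡ e
push-pull I e e⊆I = lookup-ext pointwise
  where
  pointwise : ∀ v → lookup (push I (pull I e)) v ≡ lookup e v
  pointwise v with bool-cases (lookup I v)
  ... | inj₁ v∈I = ≡.trans (lookup-push-∈ I (pull I e) v v∈I)
                     (≡.trans (lookup-pull I e (rank I v v∈I)) (≡.cong (lookup e) (embed-rank I v v∈I)))
  ... | inj₂ v∉I with bool-cases (lookup e v)
  ...   | inj₁ v∈e = ⊥-elim (true≢false (≡.trans (≡.sym (e⊆I v v∈e)) v∉I))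
  ...   | inj₂ v∉e = ≡.trans (lookup-push-∉ I (pull I e) v v∉I) (≡.sym v∉e)

push-⊆ : ∀ {n} (I : Vec Bool n) e → push I e ⊆ I
push-⊆ I e v p with bool-cases (lookup I v)
... | inj₁ v∈I = v∈I
... | inj₂ v∉I = ⊥-elim (true≢false (≡.trans (≡.sym p) (lookup-push-∉ I e v v∉I)))

push-mono : ∀ {n} (I : Vec Bool n) e J → e ⊆ J → push I e ⊆ push I J
push-mono I e J e⊆J v p with bool-cases (lookup I v)
... | inj₁ v∈I = ≡.trans (lookup-push-∈ I J v v∈I) (e⊆J (rank I v v∈I) (≡.trans (≡.sym (lookup-push-∈ I e v v∈I)) p))
... | inj₂ v∉I = ⊥-elim (true≢false (≡.trans (≡.sym p) (lookup-push-∉ I e v v∉I)))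

pull-⊆ : ∀ {n} (I : Vec Bool n) e J → e ⊆ push I J → pull I e ⊆ J
pull-⊆ I e J e⊆ k p = ≡.trans (≡.sym (≡.cong (lookup J) (rank-embed I k (embed-∈ I k))))
  (≡.trans (≡.sym (lookup-push-∈ I J (embed I k) (embed-∈ I k))) (e⊆ (embed I k) (≡.trans (≡.sym (lookup-pull I e k)) p)))

isEmpty-push : ∀ {n} (I : Vec Bool n) J → isEmptyᵇ (push I J) ≡ isEmptyᵇ J
isEmpty-push []          []          = ≡.refl
isEmpty-push (true ∷ I)  (true ∷ J)  = ≡.refl
isEmpty-push (true ∷ I)  (false ∷ J) = isEmpty-push I J
isEmpty-push (false ∷ I) J           = isEmpty-push I J

push-∁ : ∀ {n} (I : Vec Bool n) J → push I (∁ J) ≡ I ∖ push I J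
push-∁ []          []      = ≡.refl
push-∁ (true ∷ I)  (b ∷ J) = ≡.cong (not b ∷_) (push-∁ I J)
push-∁ (false ∷ I) J       = ≡.cong (false ∷_) (push-∁ I J)

push-∖ : ∀ {n} (I : Vec Bool n) X T → push I (X ∖ T) ≡ push I X ∖ push I T
push-∖ []          []      []      = ≡.refl
push-∖ (true ∷ I)  (x ∷ X) (t ∷ T) = ≡.cong ((x ∧ not t) ∷_) (push-∖ I X T)
push-∖ (false ∷ I) X       T       = ≡.cong (false ∷_) (push-∖ I X T)

⊆ᵇ-push : ∀ {n} (I : Vec Bool n) T X → (push I T ⊆ᵇ push I X) ≡ (T ⊆ᵇ X)
⊆ᵇ-push []          []      []      = ≡.refl
⊆ᵇ-push (true ∷ I)  (t ∷ T) (x ∷ X) = ≡.cong ((not t ∨ x) ∧_) (⊆ᵇ-push I T X)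
⊆ᵇ-push (false ∷ I) T       X       = ⊆ᵇ-push I T X

⊆ᵇ-push⇒⊆ᵇ : ∀ {n} (I : Vec Bool n) T X → (T ⊆ᵇ push I X) ≡ true → (T ⊆ᵇ I) ≡ true
⊆ᵇ-push⇒⊆ᵇ []          []          []      _ = ≡.refl
⊆ᵇ-push⇒⊆ᵇ (true ∷ I)  (true ∷ T)  (x ∷ X) p = ⊆ᵇ-push⇒⊆ᵇ I T X (∧-r {x} p)
⊆ᵇ-push⇒⊆ᵇ (true ∷ I)  (false ∷ T) (x ∷ X) p = ⊆ᵇ-push⇒⊆ᵇ I T X p
⊆ᵇ-push⇒⊆ᵇ (false ∷ I) (false ∷ T) X       p = ⊆ᵇ-push⇒⊆ᵇ I T X p

-- Independent sets

discrete⁺ : ∀ {n} (G : Hyp n) → (∀ e → edge G e ≡ false) → discrete G ≡ true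
discrete⁺ {n} G h = and-map⁺ (λ e → not (edge G e)) (allSubsets n) (λ e _ → not≡true⁺ (h e))

discrete⁻ : ∀ {n} (G : Hyp n) → discrete G ≡ true → ∀ e → edge G e ≡ false
discrete⁻ {n} G p e = not≡true⁻ (and-map⁻ (λ e → not (edge G e)) (allSubsets n) p e (∈-allSubsets e))

independent : ∀ {n} → Hyp n → Vec Bool n → Bool
independent G Y = discrete (restrict G Y)

independent⁺ : ∀ {n} (G : Hyp n) Y → (∀ e → e ⊆ Y → edge G e ≡ false) → independent G Y ≡ true
independent⁺ G Y h = discrete⁺ (restrict G Y) (λ e → h (push Y e) (push-⊆ Y e))

independent⁻ : ∀ {n} (G : Hyp n) Y → independent G Y ≡ true → ∀ e → e ⊆ Y → edge G e ≡ false
independent⁻ G Y p e e⊆Y = ≡.trans (≡.cong (edge G) (≡.sym (push-pull Y e e⊆Y))) (discrete⁻ (restrict G Y) p (pull Y e))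

independent-restrict : ∀ {n} (G : Hyp n) X Y → independent (restrict G X) Y ≡ independent G (push X Y)
independent-restrict G X Y = bool-ext to from
  where
  to : independent (restrict G X) Y ≡ true → independent G (push X Y) ≡ true
  to p = independent⁺ G (push X Y) (λ e e⊆ →
    ≡.trans (≡.cong (edge G) (≡.sym (push-pull X e (⊆-trans {A = e} {push X Y} {X} e⊆ (push-⊆ X Y)))))
            (independent⁻ (restrict G X) Y p (pull X e) (pull-⊆ X e Y e⊆)))
  from : independent G (push X Y) ≡ true → independent (restrict G X) Y ≡ true
  from p = independent⁺ (restrict G X) Y (λ e e⊆ → independent⁻ G (push X Y) p (push X e) (push-mono X e Y e⊆))

⊆-empty : ∀ {n} (e Y : Vec Bool n) → e ⊆ Y → isEmptyᵇ Y ≡ true → isEmptyᵇ e ≡ true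
⊆-empty e Y e⊆Y Y-empty = isEmpty⁺ e λ i → lemma i (bool-cases (lookup e i))
  where
  lemma : ∀ i → (lookup e i ≡ true) ⊎ (lookup e i ≡ false) → lookup e i ≡ false
  lemma i (inj₁ i∈e) = ⊥-elim (true≢false (≡.trans (≡.sym (e⊆Y i i∈e)) (isEmpty⁻ Y Y-empty i)))
  lemma i (inj₂ i∉e) = i∉e

empty-independent : ∀ {n} (G : Hyp n) Y → isEmptyᵇ Y ≡ true → independent G Y ≡ true
empty-independent G Y Y-empty = independent⁺ G Y no-edge
  where
  no-edge : ∀ e → e ⊆ Y → edge G e ≡ false
  no-edge e e⊆Y with bool-cases (edge G e)
  ... | inj₂ e∉G = e∉G
  ... | inj₁ e∈G with ≡.subst (2 ≤_) (empty-size e (⊆-empty e Y e⊆Y Y-empty)) (wf G e e∈G)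
  ...   | ()

discrete≡independent-full : ∀ {n} (G : Hyp n) → discrete G ≡ independent G (full n)
discrete≡independent-full {n} G = bool-ext
  (λ p → independent⁺ G (full n) (λ e _ → discrete⁻ G p e))
  (λ p → discrete⁺ G (λ e → independent⁻ G (full n) p e (λ i _ → lookup-full n i)))

edge-⊔ : ∀ {n m} (A : Hyp n) (B : Hyp m) u v →
         edge (A ⊔ₕ B) (u ++ᵥ v) ≡ (edge A u ∧ isEmptyᵇ v) ∨ (isEmptyᵇ u ∧ edge B v)
edge-⊔ A B u v = ≡.cong (λ s → (edge A (proj₁ s) ∧ isEmptyᵇ (proj₂ s)) ∨ (isEmptyᵇ (proj₁ s) ∧ edge B (proj₂ s)))
                        (splitV-++ u v)

independent-⊔ : ∀ {n m} (A : Hyp n) (B : Hyp m) T₁ T₂ →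
                independent (A ⊔ₕ B) (T₁ ++ᵥ T₂) ≡ independent A T₁ ∧ independent B T₂
independent-⊔ {n} {m} A B T₁ T₂ = bool-ext to from
  where
  left-edge : ∀ a b → (a ∧ true) ∨ b ≡ false → a ≡ false
  left-edge false _ _ = ≡.refl
  right-edge : ∀ a b → a ∨ (true ∧ b) ≡ false → b ≡ false
  right-edge false _ p = p
  no-edge : ∀ x y → (false ∧ x) ∨ (y ∧ false) ≡ false
  no-edge _ true  = ≡.refl
  no-edge _ false = ≡.refl
  to : independent (A ⊔ₕ B) (T₁ ++ᵥ T₂) ≡ true → (independent A T₁ ∧ independent B T₂) ≡ true
  to p = ∧-intro
    (independent⁺ A T₁ (λ e₁ s₁ → left-edge (edge A e₁) _
      (≡.trans (≡.cong (λ b → (edge A e₁ ∧ b) ∨ (isEmptyᵇ e₁ ∧ edge B (∅ m))) (≡.sym (isEmpty-∅ m)))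
        (≡.trans (≡.sym (edge-⊔ A B e₁ (∅ m)))
          (independent⁻ (A ⊔ₕ B) (T₁ ++ᵥ T₂) p (e₁ ++ᵥ ∅ m) (++-⊆⁺ {e₁ = e₁} {T₁} s₁ (∅-⊆ T₂)))))))
    (independent⁺ B T₂ (λ e₂ s₂ → right-edge _ (edge B e₂)
      (≡.trans (≡.cong (λ b → (edge A (∅ n) ∧ isEmptyᵇ e₂) ∨ (b ∧ edge B e₂)) (≡.sym (isEmpty-∅ n)))
        (≡.trans (≡.sym (edge-⊔ A B (∅ n) e₂))
          (independent⁻ (A ⊔ₕ B) (T₁ ++ᵥ T₂) p (∅ n ++ᵥ e₂) (++-⊆⁺ {e₁ = ∅ n} {T₁} (∅-⊆ T₁) s₂))))))
  from : (independent A T₁ ∧ independent B T₂) ≡ true → independent (A ⊔ₕ B) (T₁ ++ᵥ T₂) ≡ true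
  from p = independent⁺ (A ⊔ₕ B) (T₁ ++ᵥ T₂) λ e s →
    let e₁ = proj₁ (splitV n e)
        e₂ = proj₂ (splitV n e)
        s′ = ≡.subst (_⊆ (T₁ ++ᵥ T₂)) (≡.sym (++-splitV n e)) s
    in ≡.trans (≡.cong₂ (λ a b → (a ∧ isEmptyᵇ e₂) ∨ (isEmptyᵇ e₁ ∧ b))
                        (independent⁻ A T₁ (∧-l p) e₁ (++-⊆⁻ˡ {e₁ = e₁} {T₁} s′))
                        (independent⁻ B T₂ (∧-r {independent A T₁} p) e₂ (++-⊆⁻ʳ {e₁ = e₁} {T₁} s′)))
               (no-edge (isEmptyᵇ e₂) (isEmptyᵇ e₁))

discrete-⊔ : ∀ {n m} (A : Hyp n) (B : Hyp m) → discrete (A ⊔ₕ B) ≡ discrete A ∧ discrete B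
discrete-⊔ {n} {m} A B = begin
  discrete (A ⊔ₕ B)                            ≡⟨ discrete≡independent-full (A ⊔ₕ B) ⟩
  independent (A ⊔ₕ B) (full (n + m))          ≡⟨ ≡.cong (independent (A ⊔ₕ B)) (full-++ n) ⟩
  independent (A ⊔ₕ B) (full n ++ᵥ full m)     ≡⟨ independent-⊔ A B (full n) (full m) ⟩
  independent A (full n) ∧ independent B (full m)
    ≡⟨ ≡.sym (≡.cong₂ _∧_ (discrete≡independent-full A) (discrete≡independent-full B)) ⟩
  discrete A ∧ discrete B                      ∎
  where open ≡.≡-Reasoning

relabel : ∀ {A : Set} {n m} → Permutation n m → Vec A n → Vec A m
relabel σ v = tabulate (λ j → lookup v (σ ⟨$⟩ˡ j))

unrelabel : ∀ {A : Set} {n m} → Permutation n m → Vec A m → Vec A n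
unrelabel σ v = tabulate (λ i → lookup v (σ ⟨$⟩ʳ i))

lookup-relabel : ∀ {A : Set} {n m} (σ : Permutation n m) (v : Vec A n) j → lookup (relabel σ v) j ≡ lookup v (σ ⟨$⟩ˡ j)
lookup-relabel σ v j = Vecₚ.lookup∘tabulate _ j

relabel-unrelabel : ∀ {A : Set} {n m} (σ : Permutation n m) (v : Vec A m) → relabel σ (unrelabel σ v) ≡ v
relabel-unrelabel σ v = lookup-ext λ j →
  ≡.trans (lookup-relabel σ (unrelabel σ v) j)
          (≡.trans (Vecₚ.lookup∘tabulate (λ i → lookup v (σ ⟨$⟩ʳ i)) (σ ⟨$⟩ˡ j)) (≡.cong (lookup v) (inverseʳ σ)))

unrelabel-relabel : ∀ {A : Set} {n m} (σ : Permutation n m) (v : Vec A n) → unrelabel σ (relabel σ v) ≡ v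
unrelabel-relabel σ v = lookup-ext λ i →
  ≡.trans (Vecₚ.lookup∘tabulate (λ i → lookup (relabel σ v) (σ ⟨$⟩ʳ i)) i)
          (≡.trans (lookup-relabel σ v _) (≡.cong (lookup v) (inverseˡ σ)))

isEmpty-relabel : ∀ {n m} (σ : Permutation n m) (v : Vec Bool n) → isEmptyᵇ (relabel σ v) ≡ isEmptyᵇ v
isEmpty-relabel σ v = bool-ext
  (λ p → isEmpty⁺ v λ i → ≡.trans (≡.sym (≡.cong (lookup v) (inverseˡ σ)))
                            (≡.trans (≡.sym (lookup-relabel σ v _)) (isEmpty⁻ (relabel σ v) p (σ ⟨$⟩ʳ i))))
  (λ p → isEmpty⁺ (relabel σ v) λ j → ≡.trans (lookup-relabel σ v j) (isEmpty⁻ v p _))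

lookup-block : ∀ {m n} (a : Vec (Fin m) n) j i → lookup (block a j) i ≡ does (lookup a i Fin.≟ j)
lookup-block a j i = Vecₚ.lookup-map i (λ x → does (x Fin.≟ j)) a

block-relabel : ∀ {k n m} (σ : Permutation n m) (a : Vec (Fin k) n) j → block (relabel σ a) j ≡ relabel σ (block a j)
block-relabel σ a j = lookup-ext λ i →
  ≡.trans (lookup-block (relabel σ a) j i)
    (≡.trans (≡.cong (λ x → does (x Fin.≟ j)) (lookup-relabel σ a i))
      (≡.trans (≡.sym (lookup-block a j _)) (≡.sym (lookup-relabel σ (block a j) i))))

∁-relabel : ∀ {n m} (σ : Permutation n m) (I : Vec Bool n) → ∁ (relabel σ I) ≡ relabel σ (∁ I)
∁-relabel σ I = lookup-ext λ i →
  ≡.trans (lookup-∁ (relabel σ I) i)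
    (≡.trans (≡.cong not (lookup-relabel σ I i)) (≡.trans (≡.sym (lookup-∁ I _)) (≡.sym (lookup-relabel σ (∁ I) i))))

-- Unlike _≅_, an isomorphism here may change the (equal, but not definitionally equal) vertex count.
Iso : ∀ {n m} → Hyp n → Hyp m → Set
Iso {n} {m} G H = Σ (Permutation n m) λ σ → ∀ e → edge H (relabel σ e) ≡ edge G e

Iso-refl : ∀ {n} (G : Hyp n) → Iso G G
Iso-refl G = Perm.id , λ e → ≡.cong (edge G) (Vecₚ.tabulate∘lookup e)

module _ {n n′ m m′} (σ₁ : Permutation n n′) (σ₂ : Permutation m m′) where

  private
    on-sum : Fin n ⊎ Fin m → Fin n′ ⊎ Fin m′
    on-sum = Sum.map (σ₁ ⟨$⟩ʳ_) (σ₂ ⟨$⟩ʳ_)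

    on-sum⁻¹ : Fin n′ ⊎ Fin m′ → Fin n ⊎ Fin m
    on-sum⁻¹ = Sum.map (σ₁ ⟨$⟩ˡ_) (σ₂ ⟨$⟩ˡ_)

    on-sum-inverseʳ : ∀ s → on-sum (on-sum⁻¹ s) ≡ s
    on-sum-inverseʳ (inj₁ x) = ≡.cong inj₁ (inverseʳ σ₁)
    on-sum-inverseʳ (inj₂ y) = ≡.cong inj₂ (inverseʳ σ₂)

    on-sum-inverseˡ : ∀ s → on-sum⁻¹ (on-sum s) ≡ s
    on-sum-inverseˡ (inj₁ x) = ≡.cong inj₁ (inverseˡ σ₁)
    on-sum-inverseˡ (inj₂ y) = ≡.cong inj₂ (inverseˡ σ₂)

  _⊕ₚ_ : Permutation (n + m) (n′ + m′)
  _⊕ₚ_ = permutation (join n′ m′ ∘ on-sum ∘ splitAt n) (join n m ∘ on-sum⁻¹ ∘ splitAt n′)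
    (λ j → ≡.trans (≡.cong (join n′ m′ ∘ on-sum) (Finₚ.splitAt-join n m (on-sum⁻¹ (splitAt n′ j))))
             (≡.trans (≡.cong (join n′ m′) (on-sum-inverseʳ (splitAt n′ j))) (Finₚ.join-splitAt n′ m′ j)))
    (λ i → ≡.trans (≡.cong (join n m ∘ on-sum⁻¹) (Finₚ.splitAt-join n′ m′ (on-sum (splitAt n i))))
             (≡.trans (≡.cong (join n m) (on-sum-inverseˡ (splitAt n i))) (Finₚ.join-splitAt n m i)))

  splitV-relabel₁ : ∀ {A : Set} (e : Vec A (n + m)) → proj₁ (splitV n′ (relabel _⊕ₚ_ e)) ≡ relabel σ₁ (proj₁ (splitV n e))
  splitV-relabel₁ e = lookup-ext λ i →
    ≡.trans (lookup-splitV₁ n′ (relabel _⊕ₚ_ e) i) (≡.trans (lookup-relabel _⊕ₚ_ e _)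
      (≡.trans (≡.cong (lookup e ∘ join n m ∘ on-sum⁻¹) (Finₚ.splitAt-↑ˡ n′ i m′))
        (≡.trans (≡.sym (lookup-splitV₁ n e _)) (≡.sym (lookup-relabel σ₁ (proj₁ (splitV n e)) i)))))

  splitV-relabel₂ : ∀ {A : Set} (e : Vec A (n + m)) → proj₂ (splitV n′ (relabel _⊕ₚ_ e)) ≡ relabel σ₂ (proj₂ (splitV n e))
  splitV-relabel₂ e = lookup-ext λ i →
    ≡.trans (lookup-splitV₂ n′ (relabel _⊕ₚ_ e) i) (≡.trans (lookup-relabel _⊕ₚ_ e _)
      (≡.trans (≡.cong (lookup e ∘ join n m ∘ on-sum⁻¹) (Finₚ.splitAt-↑ʳ n′ m′ i))
        (≡.trans (≡.sym (lookup-splitV₂ n e _)) (≡.sym (lookup-relabel σ₂ (proj₂ (splitV n e)) i)))))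

Iso-⊔ : ∀ {n n′ m m′} {G : Hyp n} {G′ : Hyp n′} {H : Hyp m} {H′ : Hyp m′} →
        Iso G G′ → Iso H H′ → Iso (G ⊔ₕ H) (G′ ⊔ₕ H′)
Iso-⊔ {n} {G′ = G′} {H′ = H′} (σ₁ , e₁) (σ₂ , e₂) = σ₁ ⊕ₚ σ₂ , λ e →
  ≡.trans (≡.cong₂ (λ a b → (edge G′ a ∧ isEmptyᵇ b) ∨ (isEmptyᵇ a ∧ edge H′ b))
                   (splitV-relabel₁ σ₁ σ₂ e) (splitV-relabel₂ σ₁ σ₂ e))
          (≡.cong₂ _∨_ (≡.cong₂ _∧_ (e₁ _) (isEmpty-relabel σ₂ (proj₂ (splitV n e))))
                       (≡.cong₂ _∧_ (isEmpty-relabel σ₁ (proj₁ (splitV n e))) (e₂ _)))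

module _ {n m} (σ : Permutation n m) (I : Vec Bool n) where

  private
    J = relabel σ I

    ∈J : ∀ k → lookup J (σ ⟨$⟩ʳ embed I k) ≡ true
    ∈J k = ≡.trans (lookup-relabel σ I _) (≡.trans (≡.cong (lookup I) (inverseˡ σ)) (embed-∈ I k))

    ∈I : ∀ w → lookup J w ≡ true → lookup I (σ ⟨$⟩ˡ w) ≡ true
    ∈I w p = ≡.trans (≡.sym (lookup-relabel σ I w)) p

  restrictₚ : Permutation (size I) (size J)
  restrictₚ = permutation
    (λ k → rank J (σ ⟨$⟩ʳ embed I k) (∈J k))
    (λ k → rank I (σ ⟨$⟩ˡ embed J k) (∈I _ (embed-∈ J k)))
    (λ k → ≡.trans (rank-cong J (≡.trans (≡.cong (σ ⟨$⟩ʳ_) (embed-rank I _ _)) (inverseʳ σ)) _ (embed-∈ J k))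
                   (rank-embed J k _))
    (λ k → ≡.trans (rank-cong I (≡.trans (≡.cong (σ ⟨$⟩ˡ_) (embed-rank J _ (∈J k))) (inverseˡ σ)) _ (embed-∈ I k))
                   (rank-embed I k _))

  push-relabel : ∀ (e : Vec Bool (size I)) → push J (relabel restrictₚ e) ≡ relabel σ (push I e)
  push-relabel e = lookup-ext pointwise
    where
    pointwise : ∀ w → lookup (push J (relabel restrictₚ e)) w ≡ lookup (relabel σ (push I e)) w
    pointwise w with bool-cases (lookup J w)
    ... | inj₁ w∈J =
      ≡.trans (lookup-push-∈ J (relabel restrictₚ e) w w∈J)
        (≡.trans (lookup-relabel restrictₚ e _)
          (≡.trans (≡.cong (lookup e) (rank-cong I (≡.cong (σ ⟨$⟩ˡ_) (embed-rank J w w∈J)) _ (∈I w w∈J)))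
            (≡.trans (≡.sym (lookup-push-∈ I e (σ ⟨$⟩ˡ w) (∈I w w∈J))) (≡.sym (lookup-relabel σ (push I e) w)))))
    ... | inj₂ w∉J =
      ≡.trans (lookup-push-∉ J (relabel restrictₚ e) w w∉J)
        (≡.sym (≡.trans (lookup-relabel σ (push I e) w)
                        (lookup-push-∉ I e (σ ⟨$⟩ˡ w) (≡.trans (≡.sym (lookup-relabel σ I w)) w∉J))))

Iso-restrict : ∀ {n m} {G : Hyp n} {H : Hyp m} (i : Iso G H) (I : Vec Bool n) →
               Iso (restrict G I) (restrict H (relabel (proj₁ i) I))
Iso-restrict {H = H} (σ , σ-edge) I = restrictₚ σ I , λ e → ≡.trans (≡.cong (edge H) (push-relabel σ I e)) (σ-edge (push I e))

Iso-restrict-full : ∀ {n} (G : Hyp n) → Iso G (restrict G (full n))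
Iso-restrict-full {n} G = σ , λ e → ≡.cong (edge G) (push-full-relabel e)
  where
  X = full n
  σ : Permutation n (size X)
  σ = permutation (λ v → rank X v (lookup-full n v)) (embed X)
        (λ k → rank-embed X k (lookup-full n (embed X k))) (λ v → embed-rank X v (lookup-full n v))
  push-full-relabel : ∀ e → push X (relabel σ e) ≡ e
  push-full-relabel e = lookup-ext λ v →
    ≡.trans (lookup-push-∈ X (relabel σ e) v (lookup-full n v))
      (≡.trans (lookup-relabel σ e _) (≡.cong (lookup e) (embed-rank X v (lookup-full n v))))

-- Ordered decompositions

surjectiveᵇ : ∀ k {n} → Vec (Fin k) n → Bool
surjectiveᵇ k a = and (map (λ j → not (isEmptyᵇ (block a j))) (allFin k))

blocksIndependent : ∀ {n} → Hyp n → ∀ k → Vec (Fin k) n → Bool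
blocksIndependent G k a = and (map (λ j → independent G (block a j)) (allFin k))

surjective⇒≤ : ∀ k {n} (a : Vec (Fin k) n) → surjectiveᵇ k a ≡ true → k ≤ n
surjective⇒≤ k {n} a onto = Finₚ.injective⇒≤ {f = preimage} preimage-injective
  where
  nonempty : ∀ j → isEmptyᵇ (block a j) ≡ false
  nonempty j = not≡true⁻ (and-allFin⁻ (λ j → not (isEmptyᵇ (block a j))) onto j)
  preimage : Fin k → Fin n
  preimage j = proj₁ (nonempty⇒∈ (block a j) (nonempty j))
  a∘preimage : ∀ j → lookup a (preimage j) ≡ j
  a∘preimage j = dec-true⁻ (_ Fin.≟ j)
    (≡.trans (≡.sym (lookup-block a j (preimage j))) (proj₂ (nonempty⇒∈ (block a j) (nonempty j))))
  preimage-injective : ∀ {i j} → preimage i ≡ preimage j → i ≡ j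
  preimage-injective {i} {j} eq = ≡.trans (≡.sym (a∘preimage i)) (≡.trans (≡.cong (lookup a) eq) (a∘preimage j))

cons-block : ∀ {n k} (I : Vec Bool n) → Vec (Fin k) (size (∁ I)) → Vec (Fin (suc k)) n
cons-block []          []      = []
cons-block (true ∷ I)  a       = zero ∷ cons-block I a
cons-block (false ∷ I) (x ∷ a) = suc x ∷ cons-block I a

block-cons-block-zero : ∀ {n k} (I : Vec Bool n) (a : Vec (Fin k) (size (∁ I))) → block (cons-block I a) zero ≡ I
block-cons-block-zero []          []      = ≡.refl
block-cons-block-zero (true ∷ I)  a       = ≡.cong (true ∷_) (block-cons-block-zero I a)
block-cons-block-zero (false ∷ I) (x ∷ a) = ≡.cong (false ∷_) (block-cons-block-zero I a)

block-cons-block-suc : ∀ {n k} (I : Vec Bool n) (a : Vec (Fin k) (size (∁ I))) j →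
                       block (cons-block I a) (suc j) ≡ push (∁ I) (block a j)
block-cons-block-suc []          []      j = ≡.refl
block-cons-block-suc (true ∷ I)  a       j = ≡.cong (false ∷_) (block-cons-block-suc I a j)
block-cons-block-suc (false ∷ I) (x ∷ a) j = ≡.cong (does (x Fin.≟ j) ∷_) (block-cons-block-suc I a j)

block-map-suc : ∀ {n k} (a : Vec (Fin k) n) j → block (Vec.map suc a) (suc j) ≡ block a j
block-map-suc []      j = ≡.refl
block-map-suc (x ∷ a) j = ≡.cong (does (x Fin.≟ j) ∷_) (block-map-suc a j)

isEmpty-block-map-suc : ∀ {n k} (a : Vec (Fin k) n) → isEmptyᵇ (block (Vec.map suc a) zero) ≡ true
isEmpty-block-map-suc []      = ≡.refl
isEmpty-block-map-suc (x ∷ a) = isEmpty-block-map-suc a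

laterBlocksNonempty : ∀ k {n} → Vec (Fin (suc k)) n → Bool
laterBlocksNonempty k b = and (map (λ j → not (isEmptyᵇ (block b (suc j)))) (allFin k))

laterBlocksIndependent : ∀ {n} → Hyp n → ∀ k → Vec (Fin (suc k)) n → Bool
laterBlocksIndependent G k b = and (map (λ j → independent G (block b (suc j))) (allFin k))

surjectiveᵇ-suc : ∀ k {n} (b : Vec (Fin (suc k)) n) →
                  surjectiveᵇ (suc k) b ≡ not (isEmptyᵇ (block b zero)) ∧ laterBlocksNonempty k b
surjectiveᵇ-suc k b = and-allFin-suc (λ j → not (isEmptyᵇ (block b j)))

blocksIndependent-suc : ∀ {n} (G : Hyp n) k b →
                        blocksIndependent G (suc k) b ≡ independent G (block b zero) ∧ laterBlocksIndependent G k b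
blocksIndependent-suc G k b = and-allFin-suc (λ j → independent G (block b j))

laterBlocksNonempty-map-suc : ∀ k {n} (a : Vec (Fin k) n) → laterBlocksNonempty k (Vec.map suc a) ≡ surjectiveᵇ k a
laterBlocksNonempty-map-suc k a =
  ≡.cong and (Listₚ.map-cong (λ j → ≡.cong (not ∘ isEmptyᵇ) (block-map-suc a j)) (allFin k))

laterBlocksIndependent-map-suc : ∀ {n} (G : Hyp n) k a → laterBlocksIndependent G k (Vec.map suc a) ≡ blocksIndependent G k a
laterBlocksIndependent-map-suc G k a =
  ≡.cong and (Listₚ.map-cong (λ j → ≡.cong (independent G) (block-map-suc a j)) (allFin k))

laterBlocksNonempty-cons-block : ∀ k {n} (I : Vec Bool n) a → laterBlocksNonempty k (cons-block I a) ≡ surjectiveᵇ k a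
laterBlocksNonempty-cons-block k I a = ≡.cong and (Listₚ.map-cong (λ j →
  ≡.cong not (≡.trans (≡.cong isEmptyᵇ (block-cons-block-suc I a j)) (isEmpty-push (∁ I) (block a j)))) (allFin k))

laterBlocksIndependent-cons-block : ∀ {n} (G : Hyp n) k I a →
                                    laterBlocksIndependent G k (cons-block I a) ≡ blocksIndependent (restrict G (∁ I)) k a
laterBlocksIndependent-cons-block G k I a = ≡.cong and (Listₚ.map-cong (λ j →
  ≡.trans (≡.cong (independent G) (block-cons-block-suc I a j)) (≡.sym (independent-restrict G (∁ I) (block a j)))) (allFin k))

punchIn-inject₁-self : ∀ {k} (i : Fin k) → punchIn (inject₁ i) i ≡ suc i
punchIn-inject₁-self zero    = ≡.refl
punchIn-inject₁-self (suc i) = ≡.cong suc (punchIn-inject₁-self i)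

punchIn-cases : ∀ {k} (i : Fin (suc k)) (p : Fin (suc k)) → (p ≡ i) ⊎ Σ (Fin k) (λ q → p ≡ punchIn i q)
punchIn-cases i p with p Fin.≟ i
... | yes p≡i = inj₁ p≡i
... | no  p≢i = inj₂ (punchOut (p≢i ∘ ≡.sym) , ≡.sym (Finₚ.punchIn-punchOut (p≢i ∘ ≡.sym)))

module SplitBlock {k} (i : Fin k) where

  lo hi : Fin (suc k)
  lo = inject₁ i
  hi = suc i

  lo≢hi : lo ≢ hi
  lo≢hi eq = Finₚ.punchInᵢ≢i lo i (≡.trans (punchIn-inject₁-self i) (≡.sym eq))

  splitVertex : Fin k → Bool → Fin (suc k)
  splitVertex x t = if t then lo else punchIn lo x

  splitBlock : ∀ {n} → Vec (Fin k) n → Vec Bool n → Vec (Fin (suc k)) n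
  splitBlock []      []      = []
  splitBlock (x ∷ c) (t ∷ T) = splitVertex x t ∷ splitBlock c T

  lookup-splitBlock : ∀ {n} (c : Vec (Fin k) n) T v → lookup (splitBlock c T) v ≡ splitVertex (lookup c v) (lookup T v)
  lookup-splitBlock (x ∷ c) (t ∷ T) zero    = ≡.refl
  lookup-splitBlock (x ∷ c) (t ∷ T) (suc v) = lookup-splitBlock c T v

  private
    ≟-refl : ∀ {m} {x y : Fin m} → x ≡ y → does (x Fin.≟ y) ≡ true
    ≟-refl = dec-true (_ Fin.≟ _)

    ≟-≢ : ∀ {m} {x y : Fin m} → x ≢ y → does (x Fin.≟ y) ≡ false
    ≟-≢ = dec-false (_ Fin.≟ _)

    punchIn-≟ : ∀ x y → does (punchIn lo x Fin.≟ punchIn lo y) ≡ does (x Fin.≟ y)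
    punchIn-≟ x y = bool-ext
      (λ p → ≟-refl (Finₚ.punchIn-injective lo x y (dec-true⁻ (_ Fin.≟ _) p)))
      (λ p → ≟-refl (≡.cong (punchIn lo) (dec-true⁻ (_ Fin.≟ _) p)))

  splitVertex-lo : ∀ x t → does (splitVertex x t Fin.≟ lo) ≡ t
  splitVertex-lo x true  = ≟-refl {x = lo} ≡.refl
  splitVertex-lo x false = ≟-≢ (Finₚ.punchInᵢ≢i lo x)

  splitVertex-hi : ∀ x t → (t ≡ true → x ≡ i) → does (splitVertex x t Fin.≟ hi) ≡ does (x Fin.≟ i) ∧ not t
  splitVertex-hi x true  x≡i = ≡.trans (≟-≢ lo≢hi) (≡.sym (Boolₚ.∧-zeroʳ _))
  splitVertex-hi x false _   = ≡.trans (≡.cong (λ y → does (punchIn lo x Fin.≟ y)) (≡.sym (punchIn-inject₁-self i)))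
                                (≡.trans (punchIn-≟ x i) (≡.sym (Boolₚ.∧-identityʳ _)))

  splitVertex-other : ∀ q → q ≢ i → ∀ x t → (t ≡ true → x ≡ i) →
                      does (splitVertex x t Fin.≟ punchIn lo q) ≡ does (x Fin.≟ q)
  splitVertex-other q q≢i x true  x≡i = ≡.trans (≟-≢ (λ eq → Finₚ.punchInᵢ≢i lo q (≡.sym eq)))
                                          (≡.sym (≟-≢ (λ x≡q → q≢i (≡.trans (≡.sym x≡q) (x≡i ≡.refl)))))
  splitVertex-other q q≢i x false _   = punchIn-≟ x q

  module _ {n} (c : Vec (Fin k) n) (T : Vec Bool n) (T⊆ : (T ⊆ᵇ block c i) ≡ true) where

    private
      in-block-i : ∀ v → lookup T v ≡ true → lookup c v ≡ i
      in-block-i v p = dec-true⁻ (_ Fin.≟ i) (≡.trans (≡.sym (lookup-block c i v)) (⊆ᵇ⇒⊆ T (block c i) T⊆ v p))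

      lookup-block-splitBlock : ∀ p v → lookup (block (splitBlock c T) p) v ≡ does (splitVertex (lookup c v) (lookup T v) Fin.≟ p)
      lookup-block-splitBlock p v = ≡.trans (lookup-block (splitBlock c T) p v)
                                            (≡.cong (λ z → does (z Fin.≟ p)) (lookup-splitBlock c T v))

    block-splitBlock-lo : block (splitBlock c T) lo ≡ T
    block-splitBlock-lo = lookup-ext λ v →
      ≡.trans (lookup-block-splitBlock lo v) (splitVertex-lo (lookup c v) (lookup T v))

    block-splitBlock-hi : block (splitBlock c T) hi ≡ block c i ∖ T
    block-splitBlock-hi = lookup-ext λ v →
      ≡.trans (lookup-block-splitBlock hi v)
        (≡.trans (splitVertex-hi (lookup c v) (lookup T v) (in-block-i v))
          (≡.sym (≡.trans (lookup-∖ (block c i) T v) (≡.cong (_∧ not (lookup T v)) (lookup-block c i v)))))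

    block-splitBlock-other : ∀ q → q ≢ i → block (splitBlock c T) (punchIn lo q) ≡ block c q
    block-splitBlock-other q q≢i = lookup-ext λ v →
      ≡.trans (lookup-block-splitBlock (punchIn lo q) v)
        (≡.trans (splitVertex-other q q≢i (lookup c v) (lookup T v) (in-block-i v)) (≡.sym (lookup-block c q v)))

lookup-splitEntry-lo : ∀ {k} (a : Vec ℕ k) i j → lookup (splitEntry a i j) (inject₁ i) ≡ j
lookup-splitEntry-lo (x ∷ a) zero    j = ≡.refl
lookup-splitEntry-lo (x ∷ a) (suc i) j = lookup-splitEntry-lo a i j

lookup-splitEntry-hi : ∀ {k} (a : Vec ℕ k) i j → lookup (splitEntry a i j) (suc i) ≡ lookup a i ∸ j
lookup-splitEntry-hi (x ∷ a) zero    j = ≡.refl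
lookup-splitEntry-hi (x ∷ a) (suc i) j = lookup-splitEntry-hi a i j

lookup-splitEntry-other : ∀ {k} (a : Vec ℕ k) i j q → q ≢ i → lookup (splitEntry a i j) (punchIn (inject₁ i) q) ≡ lookup a q
lookup-splitEntry-other (x ∷ a) zero    j zero    q≢i = ⊥-elim (q≢i ≡.refl)
lookup-splitEntry-other (x ∷ a) zero    j (suc q) _   = ≡.refl
lookup-splitEntry-other (x ∷ a) (suc i) j zero    _   = ≡.refl
lookup-splitEntry-other (x ∷ a) (suc i) j (suc q) q≢i = lookup-splitEntry-other a i j q (q≢i ∘ ≡.cong suc)

module _ {c ℓ} (F : Field c ℓ) where

  open HopfAlg F hiding (zero)
  open import Relation.Binary.Reasoning.Setoid setoid
  open import Algebra.Properties.Ring ring using (-‿distribˡ-*; -‿involutive; -0#≈0#; +-cancelʳ)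
  open import Algebra.Properties.CommutativeSemigroup +-commutativeSemigroup
    using () renaming (interchange to +-interchange; x∙yz≈y∙xz to x+[y+z]≈y+[x+z])
  open import Algebra.Properties.CommutativeSemigroup *-commutativeSemigroup
    using () renaming (interchange to *-interchange; x∙yz≈y∙xz to x*[y*z]≈y*[x*z])
  import Algebra.Solver.CommutativeMonoid *-commutativeMonoid as *-Solver

  ≡⇒≈ : ∀ {x y} → x ≡ y → x ≈ y
  ≡⇒≈ ≡.refl = refl

  Σ-cong : ∀ {a} {A : Set a} (xs : List A) {f g : A → Carrier} → (∀ x → f x ≈ g x) → Σ[ xs ] f ≈ Σ[ xs ] g
  Σ-cong []       _ = refl
  Σ-cong (x ∷ xs) h = +-cong (h x) (Σ-cong xs h)

  Σ-cong-∈ : ∀ {a} {A : Set a} (xs : List A) {f g : A → Carrier} → (∀ x → x ∈ xs → f x ≈ g x) → Σ[ xs ] f ≈ Σ[ xs ] g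
  Σ-cong-∈ []       _ = refl
  Σ-cong-∈ (x ∷ xs) h = +-cong (h x (here ≡.refl)) (Σ-cong-∈ xs (λ y y∈ → h y (there y∈)))

  Σ-cong-All : ∀ {a q} {A : Set a} {Q : A → Set q} (xs : List A) {f g : A → Carrier} →
               All Q xs → (∀ x → Q x → f x ≈ g x) → Σ[ xs ] f ≈ Σ[ xs ] g
  Σ-cong-All []       []       _ = refl
  Σ-cong-All (x ∷ xs) (q ∷ qs) h = +-cong (h x q) (Σ-cong-All xs qs h)

  Σ-zero : ∀ {a} {A : Set a} (xs : List A) {f : A → Carrier} → (∀ x → f x ≈ 0#) → Σ[ xs ] f ≈ 0#
  Σ-zero []       _ = refl
  Σ-zero (x ∷ xs) h = trans (+-cong (h x) (Σ-zero xs h)) (+-identityˡ _)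

  Σ-zero-∈ : ∀ {a} {A : Set a} (xs : List A) {f : A → Carrier} → (∀ x → x ∈ xs → f x ≈ 0#) → Σ[ xs ] f ≈ 0#
  Σ-zero-∈ xs h = trans (Σ-cong-∈ xs h) (Σ-zero xs (λ _ → refl))

  Σ-++ : ∀ {a} {A : Set a} (xs ys : List A) (f : A → Carrier) → Σ[ xs ++ ys ] f ≈ Σ[ xs ] f +ₖ Σ[ ys ] f
  Σ-++ []       ys f = sym (+-identityˡ _)
  Σ-++ (x ∷ xs) ys f = trans (+-congˡ (Σ-++ xs ys f)) (sym (+-assoc _ _ _))

  Σ-map : ∀ {a b} {A : Set a} {B : Set b} (g : A → B) (xs : List A) (f : B → Carrier) → Σ[ map g xs ] f ≡ Σ[ xs ] (f ∘ g)
  Σ-map g []       f = ≡.refl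
  Σ-map g (x ∷ xs) f = ≡.cong (f (g x) +ₖ_) (Σ-map g xs f)

  Σ-concatMap : ∀ {a b} {A : Set a} {B : Set b} (g : A → List B) (xs : List A) (f : B → Carrier) →
                Σ[ concatMap g xs ] f ≈ Σ[ xs ] (λ x → Σ[ g x ] f)
  Σ-concatMap g []       f = refl
  Σ-concatMap g (x ∷ xs) f = trans (Σ-++ (g x) (concatMap g xs) f) (+-congˡ (Σ-concatMap g xs f))

  Σ-+ : ∀ {a} {A : Set a} (xs : List A) (f g : A → Carrier) → Σ[ xs ] (λ x → f x +ₖ g x) ≈ Σ[ xs ] f +ₖ Σ[ xs ] g
  Σ-+ []       f g = sym (+-identityˡ _)
  Σ-+ (x ∷ xs) f g = begin
    (f x +ₖ g x) +ₖ Σ[ xs ] (λ x → f x +ₖ g x) ≈⟨ +-congˡ (Σ-+ xs f g) ⟩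
    (f x +ₖ g x) +ₖ (Σ[ xs ] f +ₖ Σ[ xs ] g)   ≈⟨ +-interchange (f x) (g x) _ _ ⟩
    (f x +ₖ Σ[ xs ] f) +ₖ (g x +ₖ Σ[ xs ] g)   ∎

  Σ-*ˡ : ∀ {a} {A : Set a} (k : Carrier) (xs : List A) (f : A → Carrier) → k *ₖ Σ[ xs ] f ≈ Σ[ xs ] (λ x → k *ₖ f x)
  Σ-*ˡ k []       f = zeroʳ k
  Σ-*ˡ k (x ∷ xs) f = trans (distribˡ k _ _) (+-congˡ (Σ-*ˡ k xs f))

  Σ-*ʳ : ∀ {a} {A : Set a} (k : Carrier) (xs : List A) (f : A → Carrier) → Σ[ xs ] f *ₖ k ≈ Σ[ xs ] (λ x → f x *ₖ k)
  Σ-*ʳ k xs f = trans (*-comm _ _) (trans (Σ-*ˡ k xs f) (Σ-cong xs (λ x → *-comm _ _)))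

  Σ-swap : ∀ {a b} {A : Set a} {B : Set b} (xs : List A) (ys : List B) (f : A → B → Carrier) →
           Σ[ xs ] (λ x → Σ[ ys ] (f x)) ≈ Σ[ ys ] (λ y → Σ[ xs ] (λ x → f x y))
  Σ-swap []       ys f = sym (Σ-zero ys (λ _ → refl))
  Σ-swap (x ∷ xs) ys f = trans (+-congˡ (Σ-swap xs ys f)) (sym (Σ-+ ys (f x) (λ y → Σ[ xs ] (λ x → f x y))))

  Σ-filter : ∀ {a} {A : Set a} (p : A → Bool) (xs : List A) (f : A → Carrier) →
             Σ[ filterᵇ p xs ] f ≈ Σ[ xs ] (λ x → if p x then f x else 0#)
  Σ-filter p []       f = refl
  Σ-filter p (x ∷ xs) f with p x
  ... | true  = +-congˡ (Σ-filter p xs f)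
  ... | false = trans (Σ-filter p xs f) (sym (+-identityˡ _))

  Σ-insert : ∀ {a} {A : Set a} (ys₁ : List A) x ys₂ (f : A → Carrier) → Σ[ ys₁ ++ x ∷ ys₂ ] f ≈ f x +ₖ Σ[ ys₁ ++ ys₂ ] f
  Σ-insert []        x ys₂ f = refl
  Σ-insert (y ∷ ys₁) x ys₂ f = begin
    f y +ₖ Σ[ ys₁ ++ x ∷ ys₂ ] f      ≈⟨ +-congˡ (Σ-insert ys₁ x ys₂ f) ⟩
    f y +ₖ (f x +ₖ Σ[ ys₁ ++ ys₂ ] f) ≈⟨ x+[y+z]≈y+[x+z] _ _ _ ⟩
    f x +ₖ (f y +ₖ Σ[ ys₁ ++ ys₂ ] f) ∎

  Σ-same-elements : ∀ {A : Set} (xs ys : List A) (f : A → Carrier) → Unique xs → Unique ys →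
                    (∀ x → x ∈ xs → x ∈ ys) → (∀ y → y ∈ ys → y ∈ xs) → Σ[ xs ] f ≈ Σ[ ys ] f
  Σ-same-elements []       []       f _ _ _ _ = refl
  Σ-same-elements []       (y ∷ ys) f _ _ _ ys⊆xs with ys⊆xs y (here ≡.refl)
  ... | ()
  Σ-same-elements (x ∷ xs) ys f (x∉ ∷ !xs) !ys xs⊆ys ys⊆xs with ∈-∃++ (xs⊆ys x (here ≡.refl))
  ... | ys₁ , ys₂ , ≡.refl with Unique-insert⁻ ys₁ !ys
  ...   | !ys′ , x∉ys′ =
    trans (+-congˡ (Σ-same-elements xs (ys₁ ++ ys₂) f !xs !ys′ xs⊆ys′ ys′⊆xs)) (sym (Σ-insert ys₁ x ys₂ f))
    where
    xs⊆ys′ : ∀ z → z ∈ xs → z ∈ ys₁ ++ ys₂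
    xs⊆ys′ z z∈ with ∈-insert⁻ ys₁ (xs⊆ys z (there z∈))
    ... | inj₁ ≡.refl = ⊥-elim (All.lookup x∉ z∈ ≡.refl)
    ... | inj₂ z∈′    = z∈′
    ys′⊆xs : ∀ z → z ∈ ys₁ ++ ys₂ → z ∈ xs
    ys′⊆xs z z∈ with ys⊆xs z (∈-insert⁺ ys₁ z∈)
    ... | here ≡.refl = ⊥-elim (x∉ys′ z∈)
    ... | there z∈xs  = z∈xs

  Σ-reindex : ∀ {A B : Set} (xs : List A) (ys : List B) (φ : A → B) (ψ : B → A) →
              (∀ a → ψ (φ a) ≡ a) → (∀ b → φ (ψ b) ≡ b) → Unique xs → Unique ys →
              (∀ a → a ∈ xs) → (∀ b → b ∈ ys) → (f : B → Carrier) → Σ[ xs ] (f ∘ φ) ≈ Σ[ ys ] f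
  Σ-reindex xs ys φ ψ ψ∘φ φ∘ψ !xs !ys all-xs all-ys f =
    trans (≡⇒≈ (≡.sym (Σ-map φ xs f)))
      (Σ-same-elements (map φ xs) ys f (Uniqueₚ.map⁺ φ-injective !xs) !ys (λ b _ → all-ys b)
        (λ b _ → ≡.subst (_∈ map φ xs) (φ∘ψ b) (∈-map⁺ φ (all-xs (ψ b)))))
    where
    φ-injective : ∀ {a a′} → φ a ≡ φ a′ → a ≡ a′
    φ-injective {a} {a′} eq = ≡.trans (≡.sym (ψ∘φ a)) (≡.trans (≡.cong ψ eq) (ψ∘φ a′))

  Σ-reindex-allSubsets : ∀ {n} (φ ψ : Vec Bool n → Vec Bool n) → (∀ a → ψ (φ a) ≡ a) → (∀ b → φ (ψ b) ≡ b) →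
                         (f : Vec Bool n → Carrier) → Σ[ allSubsets n ] (f ∘ φ) ≈ Σ[ allSubsets n ] f
  Σ-reindex-allSubsets {n} φ ψ ψ∘φ φ∘ψ =
    Σ-reindex (allSubsets n) (allSubsets n) φ ψ ψ∘φ φ∘ψ (Unique-allSubsets n) (Unique-allSubsets n) ∈-allSubsets ∈-allSubsets

  Σ-reindex-allAssign : ∀ {k n} (φ ψ : Vec (Fin k) n → Vec (Fin k) n) → (∀ a → ψ (φ a) ≡ a) → (∀ b → φ (ψ b) ≡ b) →
                        (f : Vec (Fin k) n → Carrier) → Σ[ allAssign k n ] (f ∘ φ) ≈ Σ[ allAssign k n ] f
  Σ-reindex-allAssign {k} {n} φ ψ ψ∘φ φ∘ψ =
    Σ-reindex (allAssign k n) (allAssign k n) φ ψ ψ∘φ φ∘ψ (Unique-allAssign k n) (Unique-allAssign k n) ∈-allAssign ∈-allAssign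

  Σ-allSubsets-suc : ∀ {n} (g : Vec Bool (suc n) → Carrier) →
                     Σ[ allSubsets (suc n) ] g ≈ Σ[ allSubsets n ] (g ∘ (false ∷_)) +ₖ Σ[ allSubsets n ] (g ∘ (true ∷_))
  Σ-allSubsets-suc {n} g = trans (Σ-++ (map (false ∷_) (allSubsets n)) (map (true ∷_) (allSubsets n)) g)
    (+-cong (≡⇒≈ (Σ-map (false ∷_) (allSubsets n) g)) (≡⇒≈ (Σ-map (true ∷_) (allSubsets n) g)))

  Σ-allAssign-suc : ∀ {k n} (g : Vec (Fin k) (suc n) → Carrier) →
                    Σ[ allAssign k (suc n) ] g ≈ Σ[ allAssign k n ] (λ v → Σ[ allFin k ] (λ x → g (x ∷ v)))
  Σ-allAssign-suc {k} {n} g = trans (Σ-concatMap (λ v → map (_∷ v) (allFin k)) (allAssign k n) g)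
    (Σ-cong (allAssign k n) (λ v → ≡⇒≈ (Σ-map (_∷ v) (allFin k) g)))

  Σ-allFin-suc : ∀ {k} (h : Fin (suc k) → Carrier) → Σ[ allFin (suc k) ] h ≈ h zero +ₖ Σ[ allFin k ] (h ∘ suc)
  Σ-allFin-suc {k} h = +-congˡ (≡⇒≈ (≡.trans (≡.cong (λ xs → Σ[ xs ] h) (≡.sym (Listₚ.map-tabulate id suc)))
                                              (Σ-map suc (allFin k) h)))

  Σ-allFin-punchIn : ∀ {k} (i : Fin (suc k)) (h : Fin (suc k) → Carrier) →
                     Σ[ allFin (suc k) ] h ≈ h i +ₖ Σ[ allFin k ] (h ∘ punchIn i)
  Σ-allFin-punchIn zero h = Σ-allFin-suc h
  Σ-allFin-punchIn {suc k} (suc i) h = begin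
    Σ[ allFin (suc (suc k)) ] h                                    ≈⟨ Σ-allFin-suc h ⟩
    h zero +ₖ Σ[ allFin (suc k) ] (h ∘ suc)                        ≈⟨ +-congˡ (Σ-allFin-punchIn i (h ∘ suc)) ⟩
    h zero +ₖ (h (suc i) +ₖ Σ[ allFin k ] (h ∘ suc ∘ punchIn i))   ≈⟨ x+[y+z]≈y+[x+z] _ _ _ ⟩
    h (suc i) +ₖ (h zero +ₖ Σ[ allFin k ] (h ∘ suc ∘ punchIn i))   ≈⟨ +-congˡ (sym (Σ-allFin-suc (h ∘ punchIn (suc i)))) ⟩
    h (suc i) +ₖ Σ[ allFin (suc k) ] (h ∘ punchIn (suc i))         ∎

  Σ-applyUpTo-extend : ∀ a b (f : ℕ → ℕ) (g : ℕ → Carrier) → a ≤ b → (∀ k → a ≤ k → g (f k) ≈ 0#) →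
                       Σ[ applyUpTo f a ] g ≈ Σ[ applyUpTo f b ] g
  Σ-applyUpTo-extend zero    b       f g _         vanish = sym (Σ-zero-∈ (applyUpTo f b) λ x x∈ →
    let k , _ , x≡fk = ∈-applyUpTo⁻ f x∈ in trans (≡⇒≈ (≡.cong g x≡fk)) (vanish k z≤n))
  Σ-applyUpTo-extend (suc a) (suc b) f g (s≤s a≤b) vanish =
    +-congˡ (Σ-applyUpTo-extend a b (f ∘ suc) g a≤b (λ k a≤k → vanish (suc k) (s≤s a≤k)))

  telescope : ∀ n (f : ℕ → ℕ) (t : ℕ → Carrier) → (∀ k → f (suc k) ≡ suc (f k)) →
              Σ[ applyUpTo f n ] (λ k → t k +ₖ - t (suc k)) ≈ t (f 0) +ₖ - t (f n)
  telescope zero    f t _  = sym (-‿inverseʳ _)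
  telescope (suc n) f t hf = begin
    (t (f 0) +ₖ - t (suc (f 0))) +ₖ Σ[ applyUpTo (f ∘ suc) n ] (λ k → t k +ₖ - t (suc k))
      ≈⟨ +-congˡ (telescope n (f ∘ suc) t (hf ∘ suc)) ⟩
    (t (f 0) +ₖ - t (suc (f 0))) +ₖ (t (f 1) +ₖ - t (f (suc n)))       ≈⟨ +-congˡ (+-congʳ (≡⇒≈ (≡.cong t (hf 0)))) ⟩
    (t (f 0) +ₖ - t (suc (f 0))) +ₖ (t (suc (f 0)) +ₖ - t (f (suc n))) ≈⟨ +-assoc _ _ _ ⟩
    t (f 0) +ₖ (- t (suc (f 0)) +ₖ (t (suc (f 0)) +ₖ - t (f (suc n)))) ≈⟨ +-congˡ (sym (+-assoc _ _ _)) ⟩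
    t (f 0) +ₖ ((- t (suc (f 0)) +ₖ t (suc (f 0))) +ₖ - t (f (suc n))) ≈⟨ +-congˡ (+-congʳ (-‿inverseˡ _)) ⟩
    t (f 0) +ₖ (0# +ₖ - t (f (suc n)))                                  ≈⟨ +-congˡ (+-identityˡ _) ⟩
    t (f 0) +ₖ - t (f (suc n))                                          ∎

  ⟦_⟧ : Bool → Carrier
  ⟦ b ⟧ = if b then 1# else 0#

  when : Bool → Carrier → Carrier
  when b x = if b then x else 0#

  ⟦∧⟧ : ∀ a b → ⟦ a ∧ b ⟧ ≈ ⟦ a ⟧ *ₖ ⟦ b ⟧
  ⟦∧⟧ true  b = sym (*-identityˡ _)
  ⟦∧⟧ false b = sym (zeroˡ _)

  when-cong : ∀ {b b′ x y} → b ≡ b′ → x ≈ y → when b x ≈ when b′ y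
  when-cong {true}  ≡.refl x≈y = x≈y
  when-cong {false} ≡.refl _   = refl

  when-congʳ : ∀ b {x y} → (b ≡ true → x ≈ y) → when b x ≈ when b y
  when-congʳ true  x≈y = x≈y ≡.refl
  when-congʳ false _   = refl

  when-∧ : ∀ a b x y → when (a ∧ b) (x *ₖ y) ≈ when a x *ₖ when b y
  when-∧ true  true  x y = refl
  when-∧ true  false x y = sym (zeroʳ _)
  when-∧ false b     x y = sym (zeroˡ _)

  when-when : ∀ a b x → (b ≡ true → a ≡ true) → when a (when b x) ≈ when b x
  when-when true  b     x _   = refl
  when-when false false x _   = refl
  when-when false true  x b⇒a with b⇒a ≡.refl
  ... | ()

  when-*ˡ : ∀ b k x → when b (k *ₖ x) ≈ k *ₖ when b x
  when-*ˡ true  k x = refl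
  when-*ˡ false k x = sym (zeroʳ k)

  when+when-not : ∀ b x → x ≈ when b x +ₖ when (not b) x
  when+when-not true  x = sym (+-identityʳ _)
  when+when-not false x = sym (+-identityˡ _)

  Σ-when : ∀ {a} {A : Set a} (xs : List A) b (f : A → Carrier) → Σ[ xs ] (λ x → when b (f x)) ≈ when b (Σ[ xs ] f)
  Σ-when xs true  f = refl
  Σ-when xs false f = Σ-zero xs (λ _ → refl)

  Σ-allFin-≟ : ∀ {k} (i : Fin k) (z : Carrier) → Σ[ allFin k ] (λ y → when (does (y Fin.≟ i)) z) ≈ z
  Σ-allFin-≟ {suc k} zero    z = trans (Σ-allFin-suc {k} (λ y → when (does (y Fin.≟ zero)) z))
                                        (trans (+-congˡ (Σ-zero (allFin k) (λ _ → refl))) (+-identityʳ _))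
  Σ-allFin-≟ {suc k} (suc i) z = trans (Σ-allFin-suc {k} (λ y → when (does (y Fin.≟ suc i)) z))
                                        (trans (+-identityˡ _) (Σ-allFin-≟ i z))

  Σ-Unique-≟ : ∀ (xs : List ℕ) t (h : ℕ → Carrier) → Unique xs → t ∈ xs → Σ[ xs ] (λ j → when (does (t ℕ.≟ j)) (h j)) ≈ h t
  Σ-Unique-≟ xs t h !xs t∈ with ∈-∃++ t∈
  ... | ys₁ , ys₂ , ≡.refl with Unique-insert⁻ ys₁ !xs
  ...   | _ , t∉ = trans (Σ-insert ys₁ t ys₂ _)
    (trans (+-cong (≡⇒≈ (≡.cong (λ b → when b (h t)) (dec-true (t ℕ.≟ t) ≡.refl)))
                   (Σ-zero-∈ (ys₁ ++ ys₂) λ j j∈ →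
                     ≡⇒≈ (≡.cong (λ b → when b (h j)) (dec-false (t ℕ.≟ j) (λ t≡j → t∉ (≡.subst (_∈ ys₁ ++ ys₂) (≡.sym t≡j) j∈))))))
           (+-identityʳ _))

  Iso-resp : ∀ {f} → Invariant f → ∀ {n m} {G : Hyp n} {H : Hyp m} → Iso G H → f (n , G) ≈ f (m , H)
  Iso-resp {f} inv {n} {G = G} (σ , σ-edge) = go (↔⇒≡ σ) σ σ-edge
    where
    go : ∀ {m} {H : Hyp m} → n ≡ m → (σ : Permutation n m) → (∀ e → edge H (relabel σ e) ≡ edge G e) →
         f (n , G) ≈ f (m , H)
    go {H = H} ≡.refl σ σ-edge = inv n G H (σ , σ-edge)

  Iso₂-resp : ∀ {f} → Invariant₂ f → ∀ {n m n′ m′} {G : Hyp n} {H : Hyp m} {G′ : Hyp n′} {H′ : Hyp m′} →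
              Iso G H → Iso G′ H′ → f (n , G) (n′ , G′) ≈ f (m , H) (m′ , H′)
  Iso₂-resp {f} inv {n} {n′ = n′} {G = G} {G′ = G′} (σ , σ-edge) (σ′ , σ′-edge) = go (↔⇒≡ σ) (↔⇒≡ σ′) σ σ′ σ-edge σ′-edge
    where
    go : ∀ {m m′} {H : Hyp m} {H′ : Hyp m′} → n ≡ m → n′ ≡ m′ → (σ : Permutation n m) (σ′ : Permutation n′ m′) →
         (∀ e → edge H (relabel σ e) ≡ edge G e) → (∀ e → edge H′ (relabel σ′ e) ≡ edge G′ e) →
         f (n , G) (n′ , G′) ≈ f (m , H) (m′ , H′)
    go {H = H} {H′} ≡.refl ≡.refl σ σ′ σ-edge σ′-edge = inv n G H n′ G′ H′ (σ , σ-edge) (σ′ , σ′-edge)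

  Iso-prodᴮ : ∀ {X : Set} (xs : List X) (f g : X → Basis) → (∀ x → Iso (proj₂ (f x)) (proj₂ (g x))) →
              Iso (proj₂ (prodᴮ (map f xs))) (proj₂ (prodᴮ (map g xs)))
  Iso-prodᴮ []       f g _   = Iso-refl H∅
  Iso-prodᴮ (x ∷ xs) f g iso = Iso-⊔ {G = proj₂ (f x)} {proj₂ (g x)} {proj₂ (prodᴮ (map f xs))} {proj₂ (prodᴮ (map g xs))}
                                     (iso x) (Iso-prodᴮ xs f g iso)

  linTerm : (Basis → Carrier) → Carrier × Basis → Carrier
  linTerm f p = proj₁ p *ₖ f (proj₂ p)

  lin₂Term : (Basis → Basis → Carrier) → Carrier × Basis × Basis → Carrier
  lin₂Term f p = proj₁ p *ₖ f (proj₁ (proj₂ p)) (proj₂ (proj₂ p))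

  ζ-invariant : Invariant ζ
  ζ-invariant n G H (σ , σ-edge) = ≡⇒≈ (≡.cong ⟦_⟧ (bool-ext to from))
    where
    to : discrete G ≡ true → discrete H ≡ true
    to p = discrete⁺ H λ e → ≡.trans (≡.cong (edge H) (≡.sym (relabel-unrelabel σ e)))
                                      (≡.trans (σ-edge (unrelabel σ e)) (discrete⁻ G p _))
    from : discrete H ≡ true → discrete G ≡ true
    from p = discrete⁺ G λ e → ≡.trans (≡.sym (σ-edge e)) (discrete⁻ H p _)

  ζ̄-invariant : Invariant ζ̄
  ζ̄-invariant n G H iso = *-congˡ (ζ-invariant n G H iso)

  ⊔-invariantˡ : ∀ {f} → Invariant f → ∀ h → Invariant (λ g → f (g ⊔ᴮ h))
  ⊔-invariantˡ inv (m , H) n G G′ iso = Iso-resp inv (Iso-⊔ {G = G} {G′} {H} {H} iso (Iso-refl H))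

  ⊔-invariantʳ : ∀ {f} → Invariant f → ∀ g → Invariant (λ h → f (g ⊔ᴮ h))
  ⊔-invariantʳ inv (m , G) n H H′ iso = Iso-resp inv (Iso-⊔ {G = G} {G} {H} {H′} (Iso-refl G) iso)

  blockProduct : ∀ {n} → Hyp n → ∀ k → Vec (Fin k) n → Basis
  blockProduct G k a = prodᴮ (map (λ j → (size (block a j) , restrict G (block a j))) (allFin k))

  lin-Sᴮ : ∀ (f : Basis → Carrier) {n} (G : Hyp n) →
           lin f (Sᴮ (n , G)) ≈ Σ[ upTo (suc n) ] (λ k → Σ[ allAssign k n ] (λ a →
                                  when (surjectiveᵇ k a) (sgn k *ₖ f (blockProduct G k a))))
  lin-Sᴮ f {n} G = trans (Σ-concatMap terms (upTo (suc n)) (linTerm f)) (Σ-cong (upTo (suc n)) λ k →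
    trans (≡⇒≈ (Σ-map (λ a → (sgn k , blockProduct G k a)) (filterᵇ (surjectiveᵇ k) (allAssign k n)) (linTerm f)))
          (Σ-filter (surjectiveᵇ k) (allAssign k n) _))
    where
    terms : ℕ → Elem
    terms k = map (λ a → (sgn k , blockProduct G k a)) (filterᵇ (surjectiveᵇ k) (allAssign k n))

  S-invariant : ∀ {f} → Invariant f → Invariant (λ h → lin f (Sᴮ h))
  S-invariant {f} inv n G H (σ , σ-edge) = begin
    lin f (Sᴮ (n , G))                                        ≈⟨ lin-Sᴮ f G ⟩
    Σ[ upTo (suc n) ] (λ k → Σ[ allAssign k n ] (term G k))   ≈⟨ Σ-cong (upTo (suc n)) (λ k →
      trans (Σ-cong (allAssign k n) (relabel-term {k}))
            (Σ-reindex-allAssign (relabel σ) (unrelabel σ) (unrelabel-relabel σ) (relabel-unrelabel σ) (term H k))) ⟩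
    Σ[ upTo (suc n) ] (λ k → Σ[ allAssign k n ] (term H k))   ≈⟨ sym (lin-Sᴮ f H) ⟩
    lin f (Sᴮ (n , H))                                        ∎
    where
    term : Hyp n → ∀ k → Vec (Fin k) n → Carrier
    term K k a = when (surjectiveᵇ k a) (sgn k *ₖ f (blockProduct K k a))
    relabel-term : ∀ {k} a → term G k a ≈ term H k (relabel σ a)
    relabel-term {k} a = when-cong
      (≡.cong and (Listₚ.map-cong (λ j → ≡.cong not (≡.trans (≡.sym (isEmpty-relabel σ (block a j)))
                                                             (≡.cong isEmptyᵇ (≡.sym (block-relabel σ a j)))))
                                  (allFin k)))
      (*-congˡ (Iso-resp inv (Iso-prodᴮ (allFin k) _ _ λ j →
        ≡.subst (λ X → Iso (restrict G (block a j)) (restrict H X)) (≡.sym (block-relabel σ a j))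
                (Iso-restrict {G = G} {H} (σ , σ-edge) (block a j)))))

  Δ-invariant : ∀ {f} → Invariant₂ f → Invariant (λ h → lin₂ f (Δᴮ h))
  Δ-invariant {f} inv n G H (σ , σ-edge) = begin
    lin₂ f (Δᴮ (n , G))                   ≡⟨ Σ-map (split G) (allSubsets n) (lin₂Term f) ⟩
    Σ[ allSubsets n ] (term G)            ≈⟨ Σ-cong (allSubsets n) relabel-term ⟩
    Σ[ allSubsets n ] (term H ∘ relabel σ) ≈⟨ Σ-reindex-allSubsets (relabel σ) (unrelabel σ)
                                                (unrelabel-relabel σ) (relabel-unrelabel σ) (term H) ⟩
    Σ[ allSubsets n ] (term H)            ≡⟨ ≡.sym (Σ-map (split H) (allSubsets n) (lin₂Term f)) ⟩
    lin₂ f (Δᴮ (n , H))                   ∎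
    where
    split : Hyp n → Vec Bool n → Carrier × Basis × Basis
    split K I = 1# , (size I , restrict K I) , (size (∁ I) , restrict K (∁ I))
    term : Hyp n → Vec Bool n → Carrier
    term K I = 1# *ₖ f (size I , restrict K I) (size (∁ I) , restrict K (∁ I))
    relabel-term : ∀ I → term G I ≈ term H (relabel σ I)
    relabel-term I = *-congˡ (Iso₂-resp inv (Iso-restrict {G = G} {H} (σ , σ-edge) I)
      (≡.subst (λ X → Iso (restrict G (∁ I)) (restrict H X)) (≡.sym (∁-relabel σ I))
               (Iso-restrict {G = G} {H} (σ , σ-edge) (∁ I))))

  ≋-refl : ∀ {x} → x ≋ x
  ≋-refl f _ = refl

  ≋-sym : ∀ {x y} → x ≋ y → y ≋ x
  ≋-sym x≋y f inv = sym (x≋y f inv)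

  ≋-trans : ∀ {x y z} → x ≋ y → y ≋ z → x ≋ z
  ≋-trans x≋y y≋z f inv = trans (x≋y f inv) (y≋z f inv)

  ≋₂-trans : ∀ {t u v} → t ≋₂ u → u ≋₂ v → t ≋₂ v
  ≋₂-trans t≋u u≋v f inv = trans (t≋u f inv) (u≋v f inv)

  lin-+ᴱ : ∀ f x y → lin f (x +ᴱ y) ≈ lin f x +ₖ lin f y
  lin-+ᴱ f x y = Σ-++ x y (linTerm f)

  lin-·ᴱ : ∀ f a x → lin f (a ·ᴱ x) ≈ a *ₖ lin f x
  lin-·ᴱ f a x = trans (≡⇒≈ (Σ-map (λ p → (a *ₖ proj₁ p , proj₂ p)) x (linTerm f)))
                       (trans (Σ-cong x (λ p → *-assoc _ _ _)) (sym (Σ-*ˡ a x (linTerm f))))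

  lin-*ᴱ : ∀ f x y → lin f (x *ᴱ y) ≈ lin (λ g → lin (λ h → f (g ⊔ᴮ h)) y) x
  lin-*ᴱ f x y = trans (Σ-concatMap (λ p → map (λ q → (proj₁ p *ₖ proj₁ q , proj₂ p ⊔ᴮ proj₂ q)) y) x (linTerm f))
    (Σ-cong x λ p → trans (≡⇒≈ (Σ-map (λ q → (proj₁ p *ₖ proj₁ q , proj₂ p ⊔ᴮ proj₂ q)) y (linTerm f)))
                          (trans (Σ-cong y (λ q → *-assoc _ _ _)) (sym (Σ-*ˡ (proj₁ p) y _))))

  lin₂-Δᴱ : ∀ f x → lin₂ f (Δᴱ x) ≈ lin (λ h → lin₂ f (Δᴮ h)) x
  lin₂-Δᴱ f x = trans (Σ-concatMap (λ p → map (λ t → (proj₁ p *ₖ proj₁ t , proj₂ t)) (Δᴮ (proj₂ p))) x (lin₂Term f))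
    (Σ-cong x λ p → trans (≡⇒≈ (Σ-map (λ t → (proj₁ p *ₖ proj₁ t , proj₂ t)) (Δᴮ (proj₂ p)) (lin₂Term f)))
                          (trans (Σ-cong (Δᴮ (proj₂ p)) (λ q → *-assoc _ _ _)) (sym (Σ-*ˡ (proj₁ p) (Δᴮ (proj₂ p)) _))))

  lin-Sᴱ : ∀ f x → lin f (Sᴱ x) ≈ lin (λ h → lin f (Sᴮ h)) x
  lin-Sᴱ f x = trans (Σ-concatMap (λ p → proj₁ p ·ᴱ Sᴮ (proj₂ p)) x (linTerm f))
                     (Σ-cong x (λ p → lin-·ᴱ f (proj₁ p) (Sᴮ (proj₂ p))))

  inDegree : ℕ → (Basis → Carrier) → Basis → Carrier
  inDegree d f b = when (does (proj₁ b ℕ.≟ d)) (f b)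

  lin-component : ∀ f d x → lin f (component d x) ≈ lin (inDegree d f) x
  lin-component f d x = trans (Σ-filter (λ p → does (proj₁ (proj₂ p) ℕ.≟ d)) x (linTerm f)) (Σ-cong x pointwise)
    where
    pointwise : ∀ p → when (does (proj₁ (proj₂ p) ℕ.≟ d)) (linTerm f p) ≈ linTerm (inDegree d f) p
    pointwise p = when-*ˡ (does (proj₁ (proj₂ p) ℕ.≟ d)) (proj₁ p) (f (proj₂ p))

  +ᴱ-cong : ∀ {x x′ y y′} → x ≋ x′ → y ≋ y′ → (x +ᴱ y) ≋ (x′ +ᴱ y′)
  +ᴱ-cong {x} {x′} {y} {y′} x≋ y≋ f inv = trans (lin-+ᴱ f x y) (trans (+-cong (x≋ f inv) (y≋ f inv)) (sym (lin-+ᴱ f x′ y′)))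

  ·ᴱ-cong : ∀ a {x x′} → x ≋ x′ → (a ·ᴱ x) ≋ (a ·ᴱ x′)
  ·ᴱ-cong a {x} {x′} x≋ f inv = trans (lin-·ᴱ f a x) (trans (*-congˡ (x≋ f inv)) (sym (lin-·ᴱ f a x′)))

  *ᴱ-cong : ∀ {x x′ y y′} → x ≋ x′ → y ≋ y′ → (x *ᴱ y) ≋ (x′ *ᴱ y′)
  *ᴱ-cong {x} {x′} {y} {y′} x≋ y≋ f inv = begin
    lin f (x *ᴱ y)                              ≈⟨ lin-*ᴱ f x y ⟩
    lin (λ g → lin (λ h → f (g ⊔ᴮ h)) y) x     ≈⟨ x≋ _ (λ n G H iso → Σ-cong y (λ r → *-congˡ (⊔-invariantˡ inv (proj₂ r) n G H iso))) ⟩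
    lin (λ g → lin (λ h → f (g ⊔ᴮ h)) y) x′    ≈⟨ Σ-cong x′ (λ r → *-congˡ (y≋ _ (⊔-invariantʳ inv (proj₂ r)))) ⟩
    lin (λ g → lin (λ h → f (g ⊔ᴮ h)) y′) x′   ≈⟨ sym (lin-*ᴱ f x′ y′) ⟩
    lin f (x′ *ᴱ y′)                            ∎

  Sᴱ-cong : ∀ {x x′} → x ≋ x′ → Sᴱ x ≋ Sᴱ x′
  Sᴱ-cong {x} {x′} x≋ f inv = trans (lin-Sᴱ f x) (trans (x≋ _ (S-invariant inv)) (sym (lin-Sᴱ f x′)))

  component-cong : ∀ d {x x′} → x ≋ x′ → component d x ≋ component d x′
  component-cong d {x} {x′} x≋ f inv = trans (lin-component f d x) (trans (x≋ _ inDegree-invariant) (sym (lin-component f d x′)))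
    where
    inDegree-invariant : Invariant (inDegree d f)
    inDegree-invariant n G H iso with does (n ℕ.≟ d)
    ... | true  = inv n G H iso
    ... | false = refl

  Δᴱ-cong : ∀ {x x′} → x ≋ x′ → Δᴱ x ≋₂ Δᴱ x′
  Δᴱ-cong {x} {x′} x≋ f inv = trans (lin₂-Δᴱ f x) (trans (x≋ _ (Δ-invariant inv)) (sym (lin₂-Δᴱ f x′)))

  -- The Euler character

  sgn-+ : ∀ a b → sgn (a + b) ≈ sgn a *ₖ sgn b
  sgn-+ zero    b = sym (*-identityˡ _)
  sgn-+ (suc a) b = trans (-‿cong (sgn-+ a b)) (-‿distribˡ-* _ _)

  δ₀ : ℕ → Carrier
  δ₀ zero    = 1#
  δ₀ (suc n) = 0#

  ε≡δ₀ : ∀ n (H : Hyp n) → ε (n , H) ≡ δ₀ n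
  ε≡δ₀ zero    H = ≡.refl
  ε≡δ₀ (suc n) H = ≡.refl

  δ₀-+ : ∀ a b → δ₀ (a + b) ≈ δ₀ a *ₖ δ₀ b
  δ₀-+ zero    zero    = sym (*-identityˡ _)
  δ₀-+ zero    (suc b) = sym (*-identityˡ _)
  δ₀-+ (suc a) b       = sym (zeroˡ _)

  -- ζ↾ G Y and χ↾ G X are ζ(G|_Y) and χ(G|_X), computed with subsets of the ambient vertex set Fin n.
  ζ↾ : ∀ {n} → Hyp n → Vec Bool n → Carrier
  ζ↾ G Y = ζ (size Y , restrict G Y)

  χ↾ : ∀ {n} → Hyp n → Vec Bool n → Carrier
  χ↾ {n} G X = Σ[ allSubsets n ] (λ T → when (T ⊆ᵇ X) (sgn (size T) *ₖ ζ↾ G T *ₖ ζ↾ G (X ∖ T)))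

  Σ-push : ∀ {n} (X : Vec Bool n) (g : Vec Bool n → Carrier) →
           Σ[ allSubsets (size X) ] (g ∘ push X) ≈ Σ[ allSubsets n ] (λ T → when (T ⊆ᵇ X) (g T))
  Σ-push []                g = refl
  Σ-push {suc n} (true ∷ X)  g = begin
    Σ[ allSubsets (suc (size X)) ] (g ∘ push (true ∷ X))
      ≈⟨ Σ-allSubsets-suc (g ∘ push (true ∷ X)) ⟩
    Σ[ allSubsets (size X) ] (g ∘ (false ∷_) ∘ push X) +ₖ Σ[ allSubsets (size X) ] (g ∘ (true ∷_) ∘ push X)
      ≈⟨ +-cong (Σ-push X (g ∘ (false ∷_))) (Σ-push X (g ∘ (true ∷_))) ⟩
    Σ[ allSubsets n ] (λ T → when (T ⊆ᵇ X) (g (false ∷ T))) +ₖ Σ[ allSubsets n ] (λ T → when (T ⊆ᵇ X) (g (true ∷ T)))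
      ≈⟨ sym (Σ-allSubsets-suc (λ T → when (T ⊆ᵇ (true ∷ X)) (g T))) ⟩
    Σ[ allSubsets (suc n) ] (λ T → when (T ⊆ᵇ (true ∷ X)) (g T)) ∎
  Σ-push {suc n} (false ∷ X) g = begin
    Σ[ allSubsets (size X) ] (g ∘ (false ∷_) ∘ push X)
      ≈⟨ Σ-push X (g ∘ (false ∷_)) ⟩
    Σ[ allSubsets n ] (λ T → when (T ⊆ᵇ X) (g (false ∷ T)))
      ≈⟨ sym (trans (+-congˡ (Σ-zero (allSubsets n) (λ _ → refl))) (+-identityʳ _)) ⟩
    Σ[ allSubsets n ] (λ T → when (T ⊆ᵇ X) (g (false ∷ T))) +ₖ Σ[ allSubsets n ] (λ T → when false (g (true ∷ T)))
      ≈⟨ sym (Σ-allSubsets-suc (λ T → when (T ⊆ᵇ (false ∷ X)) (g T))) ⟩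
    Σ[ allSubsets (suc n) ] (λ T → when (T ⊆ᵇ (false ∷ X)) (g T)) ∎

  ζ-restrict-restrict : ∀ {n} (G : Hyp n) X Y → ζ (size Y , restrict (restrict G X) Y) ≡ ζ↾ G (push X Y)
  ζ-restrict-restrict G X Y = ≡.cong ⟦_⟧ (independent-restrict G X Y)

  χ-restrict : ∀ {n} (G : Hyp n) X → χ (size X , restrict G X) ≈ χ↾ G X
  χ-restrict G X = trans (Σ-cong (allSubsets (size X)) pushed) (Σ-push X (λ T → sgn (size T) *ₖ ζ↾ G T *ₖ ζ↾ G (X ∖ T)))
    where
    pushed : ∀ J → sgn (size J) *ₖ ζ (size J , restrict (restrict G X) J) *ₖ ζ (size (∁ J) , restrict (restrict G X) (∁ J))
                   ≈ sgn (size (push X J)) *ₖ ζ↾ G (push X J) *ₖ ζ↾ G (X ∖ push X J)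
    pushed J = *-cong (*-cong (≡⇒≈ (≡.cong sgn (≡.sym (size-push X J)))) (≡⇒≈ (ζ-restrict-restrict G X J)))
                      (≡⇒≈ (≡.trans (ζ-restrict-restrict G X (∁ J)) (≡.cong (ζ↾ G) (push-∁ X J))))

  Eulerian⇒χ↾≈δ₀ : ∀ {n} (G : Hyp n) → Eulerian G → ∀ X → χ↾ G X ≈ δ₀ (size X)
  Eulerian⇒χ↾≈δ₀ G eul X = trans (sym (χ-restrict G X)) (trans (eul X) (≡⇒≈ (ε≡δ₀ (size X) _)))

  χ↾≈δ₀⇒Eulerian : ∀ {n} (G : Hyp n) → (∀ X → χ↾ G X ≈ δ₀ (size X)) → Eulerian G
  χ↾≈δ₀⇒Eulerian G h X = trans (χ-restrict G X) (trans (h X) (≡⇒≈ (≡.sym (ε≡δ₀ (size X) _))))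

  χ↾-restrict : ∀ {n} (G : Hyp n) I X → χ↾ (restrict G I) X ≈ χ↾ G (push I X)
  χ↾-restrict {n} G I X = begin
    χ↾ (restrict G I) X                                     ≈⟨ Σ-cong (allSubsets (size I)) pushed ⟩
    Σ[ allSubsets (size I) ] (term ∘ push I)                ≈⟨ Σ-push I term ⟩
    Σ[ allSubsets n ] (λ T → when (T ⊆ᵇ I) (term T))        ≈⟨ Σ-cong (allSubsets n) (λ T →
                                                                 when-when (T ⊆ᵇ I) (T ⊆ᵇ push I X) _ (⊆ᵇ-push⇒⊆ᵇ I T X)) ⟩
    χ↾ G (push I X)                                         ∎
    where
    term : Vec Bool n → Carrier
    term T = when (T ⊆ᵇ push I X) (sgn (size T) *ₖ ζ↾ G T *ₖ ζ↾ G (push I X ∖ T))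
    pushed : ∀ T → when (T ⊆ᵇ X) (sgn (size T) *ₖ ζ↾ (restrict G I) T *ₖ ζ↾ (restrict G I) (X ∖ T)) ≈ term (push I T)
    pushed T = when-cong (≡.sym (⊆ᵇ-push I T X))
      (*-cong (*-cong (≡⇒≈ (≡.cong sgn (≡.sym (size-push I T)))) (≡⇒≈ (ζ-restrict-restrict G I T)))
              (≡⇒≈ (≡.trans (ζ-restrict-restrict G I (X ∖ T)) (≡.cong (ζ↾ G) (push-∖ I X T)))))

  Eulerian-restrict : ∀ {n} (G : Hyp n) → Eulerian G → ∀ I → Eulerian (restrict G I)
  Eulerian-restrict G eul I = χ↾≈δ₀⇒Eulerian (restrict G I) λ X →
    trans (χ↾-restrict G I X) (trans (Eulerian⇒χ↾≈δ₀ G eul (push I X)) (≡⇒≈ (≡.cong δ₀ (size-push I X))))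

  Σ-allSubsets-+ : ∀ n {m} (g : Vec Bool (n + m) → Carrier) →
                   Σ[ allSubsets (n + m) ] g ≈ Σ[ allSubsets n ] (λ T₁ → Σ[ allSubsets m ] (λ T₂ → g (T₁ ++ᵥ T₂)))
  Σ-allSubsets-+ zero    g = sym (+-identityʳ _)
  Σ-allSubsets-+ (suc n) g = trans (Σ-allSubsets-suc g)
    (trans (+-cong (Σ-allSubsets-+ n (g ∘ (false ∷_))) (Σ-allSubsets-+ n (g ∘ (true ∷_))))
           (sym (Σ-allSubsets-suc {n} (λ T₁ → Σ[ allSubsets _ ] (λ T₂ → g (T₁ ++ᵥ T₂))))))

  ζ↾-⊔ : ∀ {n m} (A : Hyp n) (B : Hyp m) T₁ T₂ → ζ↾ (A ⊔ₕ B) (T₁ ++ᵥ T₂) ≈ ζ↾ A T₁ *ₖ ζ↾ B T₂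
  ζ↾-⊔ A B T₁ T₂ = trans (≡⇒≈ (≡.cong ⟦_⟧ (independent-⊔ A B T₁ T₂))) (⟦∧⟧ _ _)

  χ↾-⊔ : ∀ {n m} (A : Hyp n) (B : Hyp m) X₁ X₂ → χ↾ (A ⊔ₕ B) (X₁ ++ᵥ X₂) ≈ χ↾ A X₁ *ₖ χ↾ B X₂
  χ↾-⊔ {n} {m} A B X₁ X₂ = begin
    χ↾ (A ⊔ₕ B) (X₁ ++ᵥ X₂)                                           ≈⟨ Σ-allSubsets-+ n _ ⟩
    Σ[ allSubsets n ] (λ T₁ → Σ[ allSubsets m ] (λ T₂ → term (T₁ ++ᵥ T₂))) ≈⟨ Σ-cong (allSubsets n) (λ T₁ →
                                                                          Σ-cong (allSubsets m) (term-++ T₁)) ⟩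
    Σ[ allSubsets n ] (λ T₁ → Σ[ allSubsets m ] (λ T₂ → term₁ T₁ *ₖ term₂ T₂)) ≈⟨ Σ-cong (allSubsets n) (λ T₁ →
                                                                          sym (Σ-*ˡ (term₁ T₁) (allSubsets m) term₂)) ⟩
    Σ[ allSubsets n ] (λ T₁ → term₁ T₁ *ₖ χ↾ B X₂)                    ≈⟨ sym (Σ-*ʳ (χ↾ B X₂) (allSubsets n) term₁) ⟩
    χ↾ A X₁ *ₖ χ↾ B X₂                                                ∎
    where
    term : Vec Bool (n + m) → Carrier
    term T = when (T ⊆ᵇ (X₁ ++ᵥ X₂)) (sgn (size T) *ₖ ζ↾ (A ⊔ₕ B) T *ₖ ζ↾ (A ⊔ₕ B) ((X₁ ++ᵥ X₂) ∖ T))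
    term₁ : Vec Bool n → Carrier
    term₁ T₁ = when (T₁ ⊆ᵇ X₁) (sgn (size T₁) *ₖ ζ↾ A T₁ *ₖ ζ↾ A (X₁ ∖ T₁))
    term₂ : Vec Bool m → Carrier
    term₂ T₂ = when (T₂ ⊆ᵇ X₂) (sgn (size T₂) *ₖ ζ↾ B T₂ *ₖ ζ↾ B (X₂ ∖ T₂))
    regroup : ∀ s₁ s₂ d₁ d₂ e₁ e₂ → (s₁ *ₖ s₂) *ₖ (d₁ *ₖ d₂) *ₖ (e₁ *ₖ e₂) ≈ (s₁ *ₖ d₁ *ₖ e₁) *ₖ (s₂ *ₖ d₂ *ₖ e₂)
    regroup s₁ s₂ d₁ d₂ e₁ e₂ = trans (*-congʳ (*-interchange s₁ s₂ d₁ d₂)) (*-interchange (s₁ *ₖ d₁) (s₂ *ₖ d₂) e₁ e₂)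
    term-++ : ∀ T₁ T₂ → term (T₁ ++ᵥ T₂) ≈ term₁ T₁ *ₖ term₂ T₂
    term-++ T₁ T₂ = trans
      (when-cong (⊆ᵇ-++ T₁ X₁ T₂ X₂)
        (trans (*-cong (*-cong (trans (≡⇒≈ (≡.cong sgn (size-++ T₁ T₂))) (sgn-+ (size T₁) (size T₂))) (ζ↾-⊔ A B T₁ T₂))
                       (trans (≡⇒≈ (≡.cong (ζ↾ (A ⊔ₕ B)) (∖-++ X₁ T₁ X₂ T₂))) (ζ↾-⊔ A B (X₁ ∖ T₁) (X₂ ∖ T₂))))
               (regroup _ _ _ _ _ _)))
      (when-∧ (T₁ ⊆ᵇ X₁) (T₂ ⊆ᵇ X₂) _ _)

  Eulerian-⊔ : ∀ {n m} (A : Hyp n) (B : Hyp m) → Eulerian A → Eulerian B → Eulerian (A ⊔ₕ B)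
  Eulerian-⊔ {n} A B eulA eulB = χ↾≈δ₀⇒Eulerian (A ⊔ₕ B) λ X →
    ≡.subst (λ Y → χ↾ (A ⊔ₕ B) Y ≈ δ₀ (size Y)) (++-splitV n X) (multiplicative (proj₁ (splitV n X)) (proj₂ (splitV n X)))
    where
    multiplicative : ∀ X₁ X₂ → χ↾ (A ⊔ₕ B) (X₁ ++ᵥ X₂) ≈ δ₀ (size (X₁ ++ᵥ X₂))
    multiplicative X₁ X₂ = begin
      χ↾ (A ⊔ₕ B) (X₁ ++ᵥ X₂)        ≈⟨ χ↾-⊔ A B X₁ X₂ ⟩
      χ↾ A X₁ *ₖ χ↾ B X₂             ≈⟨ *-cong (Eulerian⇒χ↾≈δ₀ A eulA X₁) (Eulerian⇒χ↾≈δ₀ B eulB X₂) ⟩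
      δ₀ (size X₁) *ₖ δ₀ (size X₂)   ≈⟨ sym (δ₀-+ (size X₁) (size X₂)) ⟩
      δ₀ (size X₁ + size X₂)         ≡⟨ ≡.cong δ₀ (≡.sym (size-++ X₁ X₂)) ⟩
      δ₀ (size (X₁ ++ᵥ X₂))          ∎

  Eulerian-H∅ : Eulerian H∅
  Eulerian-H∅ [] = trans (+-identityʳ _) (trans (*-identityʳ _) (*-identityʳ _))

  Eulerian-prodᴮ : ∀ (bs : List Basis) → All (λ b → Eulerian (proj₂ b)) bs → Eulerian (proj₂ (prodᴮ bs))
  Eulerian-prodᴮ []       []           = Eulerian-H∅
  Eulerian-prodᴮ (b ∷ bs) (eul ∷ euls) = Eulerian-⊔ (proj₂ b) (proj₂ (prodᴮ bs)) eul (Eulerian-prodᴮ bs euls)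

  -- The character ζ ∘ S

  partitions : ∀ {n} → Hyp n → ℕ → Carrier
  partitions {n} G k = Σ[ allAssign k n ] (λ a → ⟦ surjectiveᵇ k a ∧ blocksIndependent G k a ⟧)

  when-⟦⟧ : ∀ a b → when a ⟦ b ⟧ ≡ ⟦ a ∧ b ⟧
  when-⟦⟧ true  b = ≡.refl
  when-⟦⟧ false b = ≡.refl

  discrete-prodᴮ : ∀ bs → discrete (proj₂ (prodᴮ bs)) ≡ and (map (discrete ∘ proj₂) bs)
  discrete-prodᴮ []       = ≡.refl
  discrete-prodᴮ (b ∷ bs) = ≡.trans (discrete-⊔ (proj₂ b) (proj₂ (prodᴮ bs))) (≡.cong (discrete (proj₂ b) ∧_) (discrete-prodᴮ bs))

  ζ-blockProduct : ∀ {n} (G : Hyp n) k a → ζ (blockProduct G k a) ≡ ⟦ blocksIndependent G k a ⟧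
  ζ-blockProduct G k a = ≡.cong ⟦_⟧ (≡.trans (discrete-prodᴮ (map blockᴮ (allFin k))) (≡.cong and (≡.sym (Listₚ.map-∘ (allFin k)))))
    where
    blockᴮ : Fin k → Basis
    blockᴮ j = size (block a j) , restrict G (block a j)

  ζ∘Sᴮ : ∀ {n} (G : Hyp n) → lin ζ (Sᴮ (n , G)) ≈ Σ[ upTo (suc n) ] (λ k → sgn k *ₖ partitions G k)
  ζ∘Sᴮ {n} G = trans (lin-Sᴮ ζ G) (Σ-cong (upTo (suc n)) λ k →
    trans (Σ-cong (allAssign k n) (term k)) (sym (Σ-*ˡ (sgn k) (allAssign k n) _)))
    where
    term : ∀ k a → when (surjectiveᵇ k a) (sgn k *ₖ ζ (blockProduct G k a))
                   ≈ sgn k *ₖ ⟦ surjectiveᵇ k a ∧ blocksIndependent G k a ⟧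
    term k a = trans (when-*ˡ (surjectiveᵇ k a) (sgn k) _)
                     (*-congˡ (≡⇒≈ (≡.trans (≡.cong (when (surjectiveᵇ k a)) (ζ-blockProduct G k a))
                                                     (when-⟦⟧ (surjectiveᵇ k a) (blocksIndependent G k a)))))

  partitions-zero : ∀ {n} (G : Hyp n) → partitions G 0 ≈ δ₀ n
  partitions-zero {zero}  G = +-identityʳ _
  partitions-zero {suc n} G = trans (Σ-allAssign-suc {0} {n} _) (Σ-zero (allAssign 0 n) (λ _ → refl))

  partitions-vanish : ∀ {n} (G : Hyp n) k → n < k → partitions G k ≈ 0#
  partitions-vanish {n} G k n<k = Σ-zero (allAssign k n) term
    where
    term : ∀ a → ⟦ surjectiveᵇ k a ∧ blocksIndependent G k a ⟧ ≈ 0#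
    term a with surjectiveᵇ k a in onto
    ... | true  = ⊥-elim (ℕₚ.<⇒≱ n<k (surjective⇒≤ k a onto))
    ... | false = refl

  ζ∘Sᴮ-upTo : ∀ {n} (G : Hyp n) N → n ≤ N → lin ζ (Sᴮ (n , G)) ≈ Σ[ upTo (suc N) ] (λ k → sgn k *ₖ partitions G k)
  ζ∘Sᴮ-upTo {n} G N n≤N = trans (ζ∘Sᴮ G) (Σ-applyUpTo-extend (suc n) (suc N) id _ (s≤s n≤N)
    (λ k n<k → trans (*-congˡ (partitions-vanish G k n<k)) (zeroʳ _)))

  Σ-cons-block : ∀ {n k} (g : Vec (Fin (suc k)) n → Carrier) →
                 Σ[ allSubsets n ] (λ I → Σ[ allAssign k (size (∁ I)) ] (g ∘ cons-block I)) ≈ Σ[ allAssign (suc k) n ] g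
  Σ-cons-block {zero}      g = +-identityʳ _
  Σ-cons-block {suc n} {k} g = begin
    Σ[ allSubsets (suc n) ] (λ I → Σ[ allAssign k (size (∁ I)) ] (g ∘ cons-block I))
      ≈⟨ Σ-allSubsets-suc (λ I → Σ[ allAssign k (size (∁ I)) ] (g ∘ cons-block I)) ⟩
    Σ[ allSubsets n ] (λ I → Σ[ allAssign k (suc (size (∁ I))) ] (g ∘ cons-block (false ∷ I)))
      +ₖ Σ[ allSubsets n ] (λ I → Σ[ allAssign k (size (∁ I)) ] (g₀ ∘ cons-block I))
      ≈⟨ +-congʳ (Σ-cong (allSubsets n) (λ I → Σ-allAssign-suc (g ∘ cons-block (false ∷ I)))) ⟩
    Σ[ allSubsets n ] (λ I → Σ[ allAssign k (size (∁ I)) ] (g₊ ∘ cons-block I))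
      +ₖ Σ[ allSubsets n ] (λ I → Σ[ allAssign k (size (∁ I)) ] (g₀ ∘ cons-block I))
      ≈⟨ trans (+-cong (Σ-cons-block g₊) (Σ-cons-block g₀)) (+-comm _ _) ⟩
    Σ[ allAssign (suc k) n ] g₀ +ₖ Σ[ allAssign (suc k) n ] g₊
      ≈⟨ sym (Σ-+ (allAssign (suc k) n) g₀ g₊) ⟩
    Σ[ allAssign (suc k) n ] (λ v → g₀ v +ₖ g₊ v)
      ≈⟨ sym (Σ-cong (allAssign (suc k) n) (λ v → Σ-allFin-suc (λ x → g (x ∷ v)))) ⟩
    Σ[ allAssign (suc k) n ] (λ v → Σ[ allFin (suc k) ] (λ x → g (x ∷ v)))
      ≈⟨ sym (Σ-allAssign-suc g) ⟩
    Σ[ allAssign (suc k) (suc n) ] g ∎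
    where
    g₀ g₊ : Vec (Fin (suc k)) n → Carrier
    g₀ v = g (zero ∷ v)
    g₊ v = Σ[ allFin k ] (λ x → g (suc x ∷ v))

  Σ-block-zero-empty : ∀ {n k} (g : Vec (Fin (suc k)) n → Carrier) →
                       Σ[ allAssign (suc k) n ] (λ b → when (isEmptyᵇ (block b zero)) (g b)) ≈ Σ[ allAssign k n ] (g ∘ Vec.map suc)
  Σ-block-zero-empty {zero}      g = refl
  Σ-block-zero-empty {suc n} {k} g = begin
    Σ[ allAssign (suc k) (suc n) ] (λ b → when (isEmptyᵇ (block b zero)) (g b))
      ≈⟨ Σ-allAssign-suc {suc k} {n} _ ⟩
    Σ[ allAssign (suc k) n ] (λ v → Σ[ allFin (suc k) ] (λ x → when (isEmptyᵇ (block (x ∷ v) zero)) (g (x ∷ v))))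
      ≈⟨ Σ-cong (allAssign (suc k) n) (λ v → trans (Σ-allFin-suc (λ x → when (isEmptyᵇ (block (x ∷ v) zero)) (g (x ∷ v))))
                                                     (+-identityˡ _)) ⟩
    Σ[ allAssign (suc k) n ] (λ v → Σ[ allFin k ] (λ x → when (isEmptyᵇ (block v zero)) (g (suc x ∷ v))))
      ≈⟨ Σ-swap (allAssign (suc k) n) (allFin k) _ ⟩
    Σ[ allFin k ] (λ x → Σ[ allAssign (suc k) n ] (λ v → when (isEmptyᵇ (block v zero)) (g (suc x ∷ v))))
      ≈⟨ Σ-cong (allFin k) (λ x → Σ-block-zero-empty (λ v → g (suc x ∷ v))) ⟩
    Σ[ allFin k ] (λ x → Σ[ allAssign k n ] (λ a → g (suc x ∷ Vec.map suc a)))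
      ≈⟨ sym (Σ-swap (allAssign k n) (allFin k) _) ⟩
    Σ[ allAssign k n ] (λ a → Σ[ allFin k ] (λ x → g (Vec.map suc (x ∷ a))))
      ≈⟨ sym (Σ-allAssign-suc {k} {n} (g ∘ Vec.map suc)) ⟩
    Σ[ allAssign k (suc n) ] (g ∘ Vec.map suc) ∎

  -- The summand of ζ ⋆ partitions: block zero is independent but may be empty.
  partitions⁰ : ∀ {n} → Hyp n → ∀ k → Vec (Fin (suc k)) n → Carrier
  partitions⁰ G k b = ⟦ independent G (block b zero) ∧ (laterBlocksNonempty k b ∧ laterBlocksIndependent G k b) ⟧

  Σ-partitions⁰ : ∀ {n} (G : Hyp n) k → Σ[ allAssign (suc k) n ] (partitions⁰ G k) ≈ partitions G k +ₖ partitions G (suc k)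
  Σ-partitions⁰ {n} G k = begin
    Σ[ allAssign (suc k) n ] (partitions⁰ G k)
      ≈⟨ Σ-cong (allAssign (suc k) n) (λ b → when+when-not (isEmptyᵇ (block b zero)) (partitions⁰ G k b)) ⟩
    Σ[ allAssign (suc k) n ] (λ b → when (isEmptyᵇ (block b zero)) (partitions⁰ G k b)
                                   +ₖ when (not (isEmptyᵇ (block b zero))) (partitions⁰ G k b))
      ≈⟨ Σ-+ (allAssign (suc k) n) _ _ ⟩
    Σ[ allAssign (suc k) n ] (λ b → when (isEmptyᵇ (block b zero)) (partitions⁰ G k b))
      +ₖ Σ[ allAssign (suc k) n ] (λ b → when (not (isEmptyᵇ (block b zero))) (partitions⁰ G k b))
      ≈⟨ +-cong (trans (Σ-block-zero-empty (partitions⁰ G k)) (Σ-cong (allAssign k n) (≡⇒≈ ∘ empty-block-zero)))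
                (Σ-cong (allAssign (suc k) n) (≡⇒≈ ∘ nonempty-block-zero)) ⟩
    partitions G k +ₖ partitions G (suc k) ∎
    where
    empty-block-zero : ∀ a → partitions⁰ G k (Vec.map suc a) ≡ ⟦ surjectiveᵇ k a ∧ blocksIndependent G k a ⟧
    empty-block-zero a = ≡.cong ⟦_⟧ (≡.cong₂ _∧_ (empty-independent G (block (Vec.map suc a) zero) (isEmpty-block-map-suc a))
      (≡.cong₂ _∧_ (laterBlocksNonempty-map-suc k a) (laterBlocksIndependent-map-suc G k a)))
    regroup : ∀ ne i₀ ts ti → when ne ⟦ i₀ ∧ (ts ∧ ti) ⟧ ≡ ⟦ (ne ∧ ts) ∧ (i₀ ∧ ti) ⟧
    regroup false _     _     _ = ≡.refl
    regroup true  true  ts    _ = ≡.refl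
    regroup true  false true  _ = ≡.refl
    regroup true  false false _ = ≡.refl
    nonempty-block-zero : ∀ b → when (not (isEmptyᵇ (block b zero))) (partitions⁰ G k b)
                                ≡ ⟦ surjectiveᵇ (suc k) b ∧ blocksIndependent G (suc k) b ⟧
    nonempty-block-zero b = ≡.trans (regroup (not (isEmptyᵇ (block b zero))) (independent G (block b zero))
                                             (laterBlocksNonempty k b) (laterBlocksIndependent G k b))
      (≡.sym (≡.cong ⟦_⟧ (≡.cong₂ _∧_ (surjectiveᵇ-suc k b) (blocksIndependent-suc G k b))))

  ζ⋆partitions : ∀ {n} (G : Hyp n) k →
                 Σ[ allSubsets n ] (λ I → ζ↾ G I *ₖ partitions (restrict G (∁ I)) k) ≈ partitions G k +ₖ partitions G (suc k)
  ζ⋆partitions {n} G k = trans (Σ-cong (allSubsets n) term) (trans (Σ-cons-block (partitions⁰ G k)) (Σ-partitions⁰ G k))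
    where
    term : ∀ I → ζ↾ G I *ₖ partitions (restrict G (∁ I)) k ≈ Σ[ allAssign k (size (∁ I)) ] (partitions⁰ G k ∘ cons-block I)
    term I = trans (Σ-*ˡ (ζ↾ G I) (allAssign k (size (∁ I))) _) (Σ-cong (allAssign k (size (∁ I))) λ a →
      trans (sym (⟦∧⟧ (independent G I) _)) (≡⇒≈ (≡.cong ⟦_⟧ (≡.sym (≡.cong₂ _∧_
        (≡.cong (independent G) (block-cons-block-zero I a))
        (≡.cong₂ _∧_ (laterBlocksNonempty-cons-block k I a) (laterBlocksIndependent-cons-block G k I a)))))))

  sgn-alternate : ∀ k x y → sgn k *ₖ (x +ₖ y) ≈ sgn k *ₖ x +ₖ - (sgn (suc k) *ₖ y)
  sgn-alternate k x y = trans (distribˡ _ _ _) (+-congˡ (trans (sym (-‿involutive _)) (-‿cong (-‿distribˡ-* _ _))))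

  -- By Takeuchi's formula the sum is an alternating sum of ζ ⋆ partitions, which telescopes.
  ζ⋆ζ∘S≈δ₀ : ∀ {n} (H : Hyp n) → Σ[ allSubsets n ] (λ I → ζ↾ H I *ₖ lin ζ (Sᴮ (size (∁ I) , restrict H (∁ I)))) ≈ δ₀ n
  ζ⋆ζ∘S≈δ₀ {n} H = begin
    Σ[ allSubsets n ] (λ I → ζ↾ H I *ₖ lin ζ (Sᴮ (size (∁ I) , restrict H (∁ I))))
      ≈⟨ Σ-cong (allSubsets n) expand ⟩
    Σ[ allSubsets n ] (λ I → Σ[ upTo (suc n) ] (λ k → sgn k *ₖ (ζ↾ H I *ₖ partitions (restrict H (∁ I)) k)))
      ≈⟨ Σ-swap (allSubsets n) (upTo (suc n)) _ ⟩
    Σ[ upTo (suc n) ] (λ k → Σ[ allSubsets n ] (λ I → sgn k *ₖ (ζ↾ H I *ₖ partitions (restrict H (∁ I)) k)))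
      ≈⟨ Σ-cong (upTo (suc n)) (λ k → trans (sym (Σ-*ˡ (sgn k) (allSubsets n) _)) (*-congˡ (ζ⋆partitions H k))) ⟩
    Σ[ upTo (suc n) ] (λ k → sgn k *ₖ (partitions H k +ₖ partitions H (suc k)))
      ≈⟨ Σ-cong (upTo (suc n)) (λ k → sgn-alternate k _ _) ⟩
    Σ[ upTo (suc n) ] (λ k → t k +ₖ - t (suc k))
      ≈⟨ telescope (suc n) id t (λ _ → ≡.refl) ⟩
    t 0 +ₖ - t (suc n)
      ≈⟨ +-cong (trans (*-identityˡ _) (partitions-zero H))
                (trans (-‿cong (trans (*-congˡ (partitions-vanish H (suc n) (ℕₚ.n<1+n n))) (zeroʳ _))) -0#≈0#) ⟩
    δ₀ n +ₖ 0#
      ≈⟨ +-identityʳ _ ⟩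
    δ₀ n ∎
    where
    t : ℕ → Carrier
    t k = sgn k *ₖ partitions H k
    expand : ∀ I → ζ↾ H I *ₖ lin ζ (Sᴮ (size (∁ I) , restrict H (∁ I)))
                   ≈ Σ[ upTo (suc n) ] (λ k → sgn k *ₖ (ζ↾ H I *ₖ partitions (restrict H (∁ I)) k))
    expand I = trans (*-congˡ (ζ∘Sᴮ-upTo (restrict H (∁ I)) n (size≤ (∁ I))))
                     (trans (Σ-*ˡ (ζ↾ H I) (upTo (suc n)) _) (Σ-cong (upTo (suc n)) (λ k → x*[y*z]≈y*[x*z] _ _ _)))

  Σ-allSubsets-∅ : ∀ {n} (g : Vec Bool n → Carrier) → Σ[ allSubsets n ] g ≡ g (∅ n) +ₖ Σ[ nonemptySubsets n ] g
  Σ-allSubsets-∅ {n} g = ≡.cong (λ xs → Σ[ xs ] g) (allSubsets≡∅∷nonemptySubsets n)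

  ζ↾-∅ : ∀ {n} (H : Hyp n) → ζ↾ H (∅ n) ≈ 1#
  ζ↾-∅ {n} H = ≡⇒≈ (≡.cong ⟦_⟧ (empty-independent H (∅ n) (isEmpty-∅ n)))

  ζ∘S-recursion : ∀ {n} (H : Hyp n) →
    lin ζ (Sᴮ (n , H)) +ₖ Σ[ nonemptySubsets n ] (λ I → ζ↾ H I *ₖ lin ζ (Sᴮ (size (∁ I) , restrict H (∁ I)))) ≈ δ₀ n
  ζ∘S-recursion {n} H = begin
    lin ζ (Sᴮ (n , H)) +ₖ Σ[ nonemptySubsets n ] term  ≈⟨ +-congʳ (sym term-∅) ⟩
    term (∅ n) +ₖ Σ[ nonemptySubsets n ] term          ≡⟨ ≡.sym (Σ-allSubsets-∅ term) ⟩
    Σ[ allSubsets n ] term                             ≈⟨ ζ⋆ζ∘S≈δ₀ H ⟩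
    δ₀ n                                               ∎
    where
    term : Vec Bool n → Carrier
    term I = ζ↾ H I *ₖ lin ζ (Sᴮ (size (∁ I) , restrict H (∁ I)))
    term-∅ : term (∅ n) ≈ lin ζ (Sᴮ (n , H))
    term-∅ = trans (*-congʳ (ζ↾-∅ H)) (trans (*-identityˡ _)
      (sym (Iso-resp {f = λ h → lin ζ (Sᴮ h)} (S-invariant ζ-invariant) {G = H} {restrict H (full n)} (Iso-restrict-full H))))

  -- χ(H) = (ζ̄ ⋆ ζ)(H), reindexed by I = V ∖ T.
  ζ̄-recursion : ∀ {n} (H : Hyp n) → Eulerian H →
    ζ̄ (n , H) +ₖ Σ[ nonemptySubsets n ] (λ I → ζ↾ H I *ₖ ζ̄ (size (∁ I) , restrict H (∁ I))) ≈ δ₀ n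
  ζ̄-recursion {n} H eul = begin
    ζ̄ (n , H) +ₖ Σ[ nonemptySubsets n ] (λ I → ζ↾ H I *ₖ ζ̄ (size (∁ I) , restrict H (∁ I)))
      ≈⟨ +-cong (sym term-full) (Σ-cong (nonemptySubsets n) (λ I →
           trans (*-comm _ _) (*-congˡ (≡⇒≈ (≡.cong (ζ↾ H) (≡.sym (∁-involutive I))))))) ⟩
    term (full n) +ₖ Σ[ nonemptySubsets n ] (term ∘ ∁)   ≡⟨ ≡.sym (Σ-allSubsets-∅ (term ∘ ∁)) ⟩
    Σ[ allSubsets n ] (term ∘ ∁)                          ≈⟨ Σ-reindex-allSubsets ∁ ∁ ∁-involutive ∁-involutive term ⟩
    Σ[ allSubsets n ] term                                ≈⟨ Σ-cong (allSubsets n) (λ T → ≡⇒≈ (≡.sym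
                                                               (≡.cong₂ (λ b X → when b (sgn (size T) *ₖ ζ↾ H T *ₖ ζ↾ H X))
                                                                        (⊆ᵇ-full T) (full-∖ T)))) ⟩
    χ↾ H (full n)                                         ≈⟨ Eulerian⇒χ↾≈δ₀ H eul (full n) ⟩
    δ₀ (size (full n))                                    ≡⟨ ≡.cong δ₀ (size-full n) ⟩
    δ₀ n                                                  ∎
    where
    term : Vec Bool n → Carrier
    term T = sgn (size T) *ₖ ζ↾ H T *ₖ ζ↾ H (∁ T)
    term-full : term (full n) ≈ ζ̄ (n , H)
    term-full = trans (*-cong (*-cong (≡⇒≈ (≡.cong sgn (size-full n)))
                                      (sym (Iso-resp {f = ζ} ζ-invariant {G = H} {restrict H (full n)} (Iso-restrict-full H))))
                              (trans (≡⇒≈ (≡.cong (ζ↾ H) (∁-involutive (∅ n)))) (ζ↾-∅ H)))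
                      (*-identityʳ _)

  -- Both recursions have the same shape, and their nonempty terms agree by induction on the number of vertices.
  ζ∘S≈ζ̄ : ∀ {n} (H : Hyp n) → Eulerian H → lin ζ (Sᴮ (n , H)) ≈ ζ̄ (n , H)
  ζ∘S≈ζ̄ {n} = <-rec (λ n → ∀ (H : Hyp n) → Eulerian H → lin ζ (Sᴮ (n , H)) ≈ ζ̄ (n , H)) step n
    where
    step : ∀ n → (∀ {m} → m < n → ∀ (H : Hyp m) → Eulerian H → lin ζ (Sᴮ (m , H)) ≈ ζ̄ (m , H)) →
           ∀ (H : Hyp n) → Eulerian H → lin ζ (Sᴮ (n , H)) ≈ ζ̄ (n , H)
    step n IH H eul = +-cancelʳ rest (lin ζ (Sᴮ (n , H))) (ζ̄ (n , H)) (begin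
      lin ζ (Sᴮ (n , H)) +ₖ rest
        ≈⟨ +-congˡ (sym (Σ-cong-All (nonemptySubsets n) (All-nonempty-nonemptySubsets n) λ I I≠∅ →
             *-congˡ (IH (nonempty⇒size-∁< I I≠∅) (restrict H (∁ I)) (Eulerian-restrict H eul (∁ I))))) ⟩
      lin ζ (Sᴮ (n , H)) +ₖ Σ[ nonemptySubsets n ] (λ I → ζ↾ H I *ₖ lin ζ (Sᴮ (size (∁ I) , restrict H (∁ I))))
        ≈⟨ trans (ζ∘S-recursion H) (sym (ζ̄-recursion H eul)) ⟩
      ζ̄ (n , H) +ₖ rest ∎)
      where
      rest : Carrier
      rest = Σ[ nonemptySubsets n ] (λ I → ζ↾ H I *ₖ ζ̄ (size (∁ I) , restrict H (∁ I)))

  -- The eulerian subalgebra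

  AllEulerian : Elem → Set (c ⊔ ℓ)
  AllEulerian = All (λ p → Eulerian (proj₂ (proj₂ p)))

  AllEulerian-Sᴮ : ∀ {n} (H : Hyp n) → Eulerian H → AllEulerian (Sᴮ (n , H))
  AllEulerian-Sᴮ {n} H eul = Allₚ.concat⁺ (Allₚ.map⁺ (All.universal (λ k →
    Allₚ.map⁺ (Allₚ.filter⁺ (T? ∘ surjectiveᵇ k) (All.universal (λ a →
      Eulerian-prodᴮ (map (λ j → (size (block a j) , restrict H (block a j))) (allFin k))
        (Allₚ.map⁺ (All.universal (λ j → Eulerian-restrict H eul (block a j)) (allFin k)))) (allAssign k n))))
    (upTo (suc n))))

  AllEulerian-·ᴱ : ∀ a {z} → AllEulerian z → AllEulerian (a ·ᴱ z)
  AllEulerian-·ᴱ a = Allₚ.map⁺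

  AllEulerian-*ᴱ : ∀ {z w} → AllEulerian z → AllEulerian w → AllEulerian (z *ᴱ w)
  AllEulerian-*ᴱ eul-z eul-w = All-concatMap⁺ _ eul-z λ p eul-p →
    Allₚ.map⁺ (All.map (λ {q} eul-q → Eulerian-⊔ (proj₂ (proj₂ p)) (proj₂ (proj₂ q)) eul-p eul-q) eul-w)

  AllEulerian-Sᴱ : ∀ {z} → AllEulerian z → AllEulerian (Sᴱ z)
  AllEulerian-Sᴱ eul-z = All-concatMap⁺ _ eul-z λ p eul-p → AllEulerian-·ᴱ (proj₁ p) (AllEulerian-Sᴮ (proj₂ (proj₂ p)) eul-p)

  InE-resp : ∀ {x y} → x ≋ y → InE x → InE y
  InE-resp {x} {y} x≋y (z , eul , x≋z) = z , eul , ≋-trans {y} {x} {z} (≋-sym {x} {y} x≋y) x≋z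

  InE-+ᴱ : ∀ {x y} → InE x → InE y → InE (x +ᴱ y)
  InE-+ᴱ {x} {y} (z , eul-z , x≋z) (w , eul-w , y≋w) = z +ᴱ w , Allₚ.++⁺ eul-z eul-w , +ᴱ-cong {x} {z} {y} {w} x≋z y≋w

  InE-·ᴱ : ∀ a {x} → InE x → InE (a ·ᴱ x)
  InE-·ᴱ a {x} (z , eul-z , x≋z) = a ·ᴱ z , AllEulerian-·ᴱ a eul-z , ·ᴱ-cong a {x} {z} x≋z

  InE-*ᴱ : ∀ {x y} → InE x → InE y → InE (x *ᴱ y)
  InE-*ᴱ {x} {y} (z , eul-z , x≋z) (w , eul-w , y≋w) =
    z *ᴱ w , AllEulerian-*ᴱ {z} {w} eul-z eul-w , *ᴱ-cong {x} {z} {y} {w} x≋z y≋w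

  InE-Sᴱ : ∀ {x} → InE x → InE (Sᴱ x)
  InE-Sᴱ {x} (z , eul-z , x≋z) = Sᴱ z , AllEulerian-Sᴱ eul-z , Sᴱ-cong {x} {z} x≋z

  InE-component : ∀ {x} → InE x → ∀ d → InE (component d x)
  InE-component {x} (z , eul-z , x≋z) d = component d z , Allₚ.filter⁺ _ eul-z , component-cong d {x} {z} x≋z

  InE-singleton : ∀ a {n} (H : Hyp n) → Eulerian H → InE [ (a , (n , H)) ]
  InE-singleton a {n} H eul = [ (a , (n , H)) ] , eul ∷ [] , ≋-refl {[ (a , (n , H)) ]}

  InE-1ᴱ : InE 1ᴱ
  InE-1ᴱ = InE-singleton 1# H∅ Eulerian-H∅

  -- Δᴱ z written as Σ u ⊗ v with single hypergraphs u = a · z|_I and v = z|_{V∖I}.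
  Δ-terms : Elem → List (Elem × Elem)
  Δ-terms z = concatMap (λ p → map (λ I → [ (proj₁ p , (size I , restrict (proj₂ (proj₂ p)) I)) ] ,
                                          [ (1# , (size (∁ I) , restrict (proj₂ (proj₂ p)) (∁ I))) ])
                                   (allSubsets (proj₁ (proj₂ p)))) z

  Δᴱ≋Δ-terms : ∀ z → Δᴱ z ≋₂ concatMap (λ q → proj₁ q ⊗ᴱ proj₂ q) (Δ-terms z)
  Δᴱ≋Δ-terms z f inv = begin
    lin₂ f (Δᴱ z)
      ≈⟨ lin₂-Δᴱ f z ⟩
    Σ[ z ] (λ p → proj₁ p *ₖ lin₂ f (Δᴮ (proj₂ p)))
      ≈⟨ Σ-cong z (λ p → trans (*-congˡ (≡⇒≈ (Σ-map _ (allSubsets (proj₁ (proj₂ p))) (lin₂Term f))))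
                               (trans (Σ-*ˡ (proj₁ p) (allSubsets (proj₁ (proj₂ p))) _)
                                      (Σ-cong (allSubsets (proj₁ (proj₂ p))) (λ I → trans (sym (*-assoc _ _ _)) (sym (+-identityʳ _)))))) ⟩
    Σ[ z ] (λ p → Σ[ allSubsets (proj₁ (proj₂ p)) ] (λ I → lin₂ f (term p I)))
      ≈⟨ Σ-cong z (λ p → ≡⇒≈ (≡.sym (Σ-map _ (allSubsets (proj₁ (proj₂ p))) (λ q → lin₂ f (proj₁ q ⊗ᴱ proj₂ q))))) ⟩
    Σ[ z ] (λ p → Σ[ map _ (allSubsets (proj₁ (proj₂ p))) ] (λ q → lin₂ f (proj₁ q ⊗ᴱ proj₂ q)))
      ≈⟨ sym (Σ-concatMap _ z _) ⟩
    Σ[ Δ-terms z ] (λ q → lin₂ f (proj₁ q ⊗ᴱ proj₂ q))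
      ≈⟨ sym (Σ-concatMap (λ q → proj₁ q ⊗ᴱ proj₂ q) (Δ-terms z) (lin₂Term f)) ⟩
    lin₂ f (concatMap (λ q → proj₁ q ⊗ᴱ proj₂ q) (Δ-terms z)) ∎
    where
    term : (p : Carrier × Basis) → Vec Bool (proj₁ (proj₂ p)) → Elem₂
    term p I = [ (proj₁ p , (size I , restrict (proj₂ (proj₂ p)) I)) ] ⊗ᴱ [ (1# , (size (∁ I) , restrict (proj₂ (proj₂ p)) (∁ I))) ]

  InE-Δᴱ : ∀ {x} → InE x → Σ (List (Elem × Elem)) λ ps →
           All (λ p → InE (proj₁ p) × InE (proj₂ p)) ps × Δᴱ x ≋₂ concatMap (λ p → proj₁ p ⊗ᴱ proj₂ p) ps
  InE-Δᴱ {x} (z , eul-z , x≋z) =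
    Δ-terms z ,
    All-concatMap⁺ _ eul-z (λ q eul-q → Allₚ.map⁺ (All.universal (λ I →
      InE-singleton (proj₁ q) (restrict (proj₂ (proj₂ q)) I) (Eulerian-restrict (proj₂ (proj₂ q)) eul-q I) ,
      InE-singleton 1# (restrict (proj₂ (proj₂ q)) (∁ I)) (Eulerian-restrict (proj₂ (proj₂ q)) eul-q (∁ I)))
      (allSubsets (proj₁ (proj₂ q))))) ,
    ≋₂-trans {Δᴱ x} {Δᴱ z} {concatMap (λ p → proj₁ p ⊗ᴱ proj₂ p) (Δ-terms z)} (Δᴱ-cong {x} {z} x≋z) (Δᴱ≋Δ-terms z)

  InE-isGradedHopfSubalgebra : IsGradedHopfSubalgebra InE
  InE-isGradedHopfSubalgebra = record
    { resp     = λ {x} {y} → InE-resp {x} {y}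
    ; zero-∈   = [] , [] , ≋-refl {[]}
    ; +-closed = λ {x} {y} → InE-+ᴱ {x} {y}
    ; ·-closed = λ a {x} → InE-·ᴱ a {x}
    ; unit-∈   = InE-1ᴱ
    ; *-closed = λ {x} {y} → InE-*ᴱ {x} {y}
    ; graded   = λ {x} → InE-component {x}
    ; Δ-closed = λ {x} → InE-Δᴱ {x}
    ; S-closed = λ {x} → InE-Sᴱ {x}
    }

  InE-isSubalgebra : IsSubalgebra InE
  InE-isSubalgebra = record
    { resp     = λ {x} {y} → InE-resp {x} {y}
    ; zero-∈   = [] , [] , ≋-refl {[]}
    ; +-closed = λ {x} {y} → InE-+ᴱ {x} {y}
    ; ·-closed = λ a {x} → InE-·ᴱ a {x}
    ; unit-∈   = InE-1ᴱ
    ; *-closed = λ {x} {y} → InE-*ᴱ {x} {y}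
    }

  ζ⁻¹≈ζ̄-on-InE : ∀ y → InE y → ζ⁻¹ᴱ y ≈ ζ̄ᴱ y
  ζ⁻¹≈ζ̄-on-InE y (z , eul-z , y≋z) = begin
    lin ζ (Sᴱ y)                  ≈⟨ Sᴱ-cong {y} {z} y≋z ζ ζ-invariant ⟩
    lin ζ (Sᴱ z)                  ≈⟨ lin-Sᴱ ζ z ⟩
    lin (λ h → lin ζ (Sᴮ h)) z    ≈⟨ Σ-cong-All z eul-z (λ q eul-q → *-congˡ (ζ∘S≈ζ̄ (proj₂ (proj₂ q)) eul-q)) ⟩
    lin ζ̄ z                       ≈⟨ sym (y≋z ζ̄ ζ̄-invariant) ⟩
    ζ̄ᴱ y                          ∎

  InE⊆InOdd : ∀ x → InE x → InOdd x
  InE⊆InOdd x x∈E = InE , InE-isGradedHopfSubalgebra , ζ⁻¹≈ζ̄-on-InE , x∈E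

  -- Dehn–Sommerville relations

  *-⟦∧⟧ : ∀ k x y → k *ₖ ⟦ x ∧ y ⟧ ≈ when x (k *ₖ ⟦ y ⟧)
  *-⟦∧⟧ k true  y = refl
  *-⟦∧⟧ k false y = zeroʳ k

  Σ-sgn-split : ∀ A t s → Σ[ upTo (suc A) ] (λ j → sgn j *ₖ ⟦ does (t ℕ.≟ j) ∧ does (s ℕ.≟ A ∸ j) ⟧)
                          ≈ sgn t *ₖ ⟦ does (t + s ℕ.≟ A) ⟧
  Σ-sgn-split A t s with t ℕ.≤? A
  ... | yes t≤A = begin
    Σ[ upTo (suc A) ] (λ j → sgn j *ₖ ⟦ does (t ℕ.≟ j) ∧ does (s ℕ.≟ A ∸ j) ⟧)
      ≈⟨ Σ-cong (upTo (suc A)) (λ j → *-⟦∧⟧ (sgn j) _ _) ⟩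
    Σ[ upTo (suc A) ] (λ j → when (does (t ℕ.≟ j)) (sgn j *ₖ ⟦ does (s ℕ.≟ A ∸ j) ⟧))
      ≈⟨ Σ-Unique-≟ (upTo (suc A)) t (λ j → sgn j *ₖ ⟦ does (s ℕ.≟ A ∸ j) ⟧) (Uniqueₚ.upTo⁺ (suc A)) (∈-upTo⁺ (s≤s t≤A)) ⟩
    sgn t *ₖ ⟦ does (s ℕ.≟ A ∸ t) ⟧
      ≡⟨ ≡.cong (λ b → sgn t *ₖ ⟦ b ⟧) (≟-∸ s t≤A) ⟩
    sgn t *ₖ ⟦ does (t + s ℕ.≟ A) ⟧ ∎
  ... | no  t≰A = trans (Σ-zero-∈ (upTo (suc A)) λ j j∈ →
                          trans (*-⟦∧⟧ (sgn j) _ _) (≡⇒≈ (≡.cong (λ b → when b (sgn j *ₖ ⟦ does (s ℕ.≟ A ∸ j) ⟧)) (dec-false (t ℕ.≟ j) (t≢j j∈)))))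
                        (sym (trans (*-congˡ (≡⇒≈ (≡.cong ⟦_⟧ (dec-false (t + s ℕ.≟ A) t+s≢A)))) (zeroʳ _)))
    where
    t≢j : ∀ {j} → j ∈ upTo (suc A) → t ≢ j
    t≢j j∈ t≡j = t≰A (≡.subst (ℕ._≤ A) (≡.sym t≡j) (ℕₚ.≤-pred (∈-upTo⁻ j∈)))
    t+s≢A : t + s ≢ A
    t+s≢A t+s≡A = t≰A (≡.subst (t ℕ.≤_) t+s≡A (ℕₚ.m≤m+n t s))

  module _ {k} (i : Fin k) where
    open SplitBlock i

    Σ-splitBlock : ∀ {n} (g : Vec (Fin (suc k)) n → Carrier) →
                   Σ[ allAssign (suc k) n ] g ≈ Σ[ allAssign k n ] (λ c → Σ[ allSubsets n ] (λ T → when (T ⊆ᵇ block c i) (g (splitBlock c T))))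
    Σ-splitBlock {zero}  g = sym (+-identityʳ _)
    Σ-splitBlock {suc n} g = begin
      Σ[ allAssign (suc k) (suc n) ] g
        ≈⟨ Σ-allAssign-suc {suc k} {n} g ⟩
      Σ[ V ] (λ v → Σ[ allFin (suc k) ] (λ x → g (x ∷ v)))
        ≈⟨ Σ-cong V (λ v → Σ-allFin-punchIn lo (λ x → g (x ∷ v))) ⟩
      Σ[ V ] (λ v → g (lo ∷ v) +ₖ Σ[ allFin k ] (λ y → g (punchIn lo y ∷ v)))
        ≈⟨ Σ-+ V _ _ ⟩
      Σ[ V ] (λ v → g (lo ∷ v)) +ₖ Σ[ V ] (λ v → Σ[ allFin k ] (λ y → g (punchIn lo y ∷ v)))
        ≈⟨ +-cong (Σ-splitBlock (λ v → g (lo ∷ v)))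
                  (trans (Σ-swap V (allFin k) _) (trans (Σ-cong (allFin k) (λ y → Σ-splitBlock (λ v → g (punchIn lo y ∷ v))))
                                                        (sym (Σ-swap C (allFin k) (λ c y → Tᵒ y c))))) ⟩
      Σ[ C ] Tˡ +ₖ Σ[ C ] (λ c → Σ[ allFin k ] (λ y → Tᵒ y c))
        ≈⟨ trans (+-comm _ _) (sym (Σ-+ C _ _)) ⟩
      Σ[ C ] (λ c → Σ[ allFin k ] (λ y → Tᵒ y c) +ₖ Tˡ c)
        ≈⟨ Σ-cong C (λ c → trans (+-congˡ (sym (Σ-allFin-≟ i (Tˡ c)))) (sym (Σ-+ (allFin k) _ _))) ⟩
      Σ[ C ] (λ c → Σ[ allFin k ] (λ y → Tᵒ y c +ₖ when (does (y Fin.≟ i)) (Tˡ c)))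
        ≈⟨ Σ-cong C (λ c → Σ-cong (allFin k) (λ y → sym (split-head y c))) ⟩
      Σ[ C ] (λ c → Σ[ allFin k ] (λ y → R (y ∷ c)))
        ≈⟨ sym (Σ-allAssign-suc {k} {n} R) ⟩
      Σ[ allAssign k (suc n) ] R ∎
      where
      V = allAssign (suc k) n
      C = allAssign k n
      R : Vec (Fin k) (suc n) → Carrier
      R c = Σ[ allSubsets (suc n) ] (λ T → when (T ⊆ᵇ block c i) (g (splitBlock c T)))
      Tᵒ : Fin k → Vec (Fin k) n → Carrier
      Tᵒ y c = Σ[ allSubsets n ] (λ T → when (T ⊆ᵇ block c i) (g (punchIn lo y ∷ splitBlock c T)))
      Tˡ : Vec (Fin k) n → Carrier
      Tˡ c = Σ[ allSubsets n ] (λ T → when (T ⊆ᵇ block c i) (g (lo ∷ splitBlock c T)))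
      when-∧ˡ : ∀ d s x → when (d ∧ s) x ≈ when d (when s x)
      when-∧ˡ true  s x = refl
      when-∧ˡ false s x = refl
      split-head : ∀ y c → R (y ∷ c) ≈ Tᵒ y c +ₖ when (does (y Fin.≟ i)) (Tˡ c)
      split-head y c = trans (Σ-allSubsets-suc {n} (λ T → when (T ⊆ᵇ block (y ∷ c) i) (g (splitBlock (y ∷ c) T)))) (+-congˡ
        (trans (Σ-cong (allSubsets n) (λ T → when-∧ˡ (does (y Fin.≟ i)) (T ⊆ᵇ block c i) _)) (Σ-when (allSubsets n) _ _)))

  ⟦≟⟧*δ₀ : ∀ m A → 1 ≤ A → ⟦ does (m ℕ.≟ A) ⟧ *ₖ δ₀ m ≈ 0#
  ⟦≟⟧*δ₀ m A 1≤A with bool-cases (does (m ℕ.≟ A))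
  ... | inj₁ m≟A = trans (*-congʳ (≡⇒≈ (≡.cong ⟦_⟧ m≟A)))
                         (trans (*-identityˡ _) (δ₀-positive (≡.subst (1 ≤_) (≡.sym (dec-true⁻ (m ℕ.≟ A) m≟A)) 1≤A)))
    where
    δ₀-positive : ∀ {m} → 1 ≤ m → δ₀ m ≈ 0#
    δ₀-positive (s≤s _) = refl
  ... | inj₂ m≠A = trans (*-congʳ (≡⇒≈ (≡.cong ⟦_⟧ m≠A))) (zeroˡ _)

  module _ {n} (H : Hyp n) {k} (a : Vec ℕ k) (i : Fin k) where
    open SplitBlock i

    fits : ∀ {m} → Vec ℕ m → Vec (Fin m) n → Fin m → Bool
    fits β b p = does (size (block b p) ℕ.≟ lookup β p) ∧ independent H (block b p)

    fitsAll : ∀ {m} → Vec ℕ m → Vec (Fin m) n → Bool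
    fitsAll {m} β b = and (map (fits β b) (allFin m))

    othersFit : Vec (Fin k) n → Bool
    othersFit c = and (map (λ q → does (q Fin.≟ i) ∨ fits a c q) (allFin k))

    fits-cong : ∀ {m} (β : Vec ℕ m) b p {Y l} → block b p ≡ Y → lookup β p ≡ l →
                fits β b p ≡ does (size Y ℕ.≟ l) ∧ independent H Y
    fits-cong β b p ≡.refl ≡.refl = ≡.refl

    ≟-∨-intro : ∀ q x → (q ≢ i → x ≡ true) → (does (q Fin.≟ i) ∨ x) ≡ true
    ≟-∨-intro q x h with q Fin.≟ i
    ... | yes _   = ≡.refl
    ... | no  q≢i = h q≢i

    ≟-∨-elim : ∀ q x → q ≢ i → (does (q Fin.≟ i) ∨ x) ≡ true → x ≡ true
    ≟-∨-elim q x q≢i p with q Fin.≟ i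
    ... | yes q≡i = ⊥-elim (q≢i q≡i)
    ... | no  _   = p

    fitsAll-splitBlock : ∀ j c T → (T ⊆ᵇ block c i) ≡ true →
      fitsAll (splitEntry a i j) (splitBlock c T)
      ≡ (does (size T ℕ.≟ j) ∧ independent H T) ∧
        ((does (size (block c i ∖ T) ℕ.≟ lookup a i ∸ j) ∧ independent H (block c i ∖ T)) ∧ othersFit c)
    fitsAll-splitBlock j c T T⊆ = bool-ext to from
      where
      β = splitEntry a i j
      b = splitBlock c T
      fits-lo = fits-cong β b lo (block-splitBlock-lo c T T⊆) (lookup-splitEntry-lo a i j)
      fits-hi = fits-cong β b hi (block-splitBlock-hi c T T⊆) (lookup-splitEntry-hi a i j)
      fits-other : ∀ q → q ≢ i → fits β b (punchIn lo q) ≡ fits a c q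
      fits-other q q≢i = fits-cong β b (punchIn lo q) (block-splitBlock-other c T T⊆ q q≢i) (lookup-splitEntry-other a i j q q≢i)
      to : fitsAll β b ≡ true → _ ≡ true
      to p = ∧-intro (≡.trans (≡.sym fits-lo) (all lo))
               (∧-intro (≡.trans (≡.sym fits-hi) (all hi))
                 (and-allFin⁺ _ λ q → ≟-∨-intro q _ λ q≢i → ≡.trans (≡.sym (fits-other q q≢i)) (all (punchIn lo q))))
        where
        all = and-allFin⁻ (fits β b) p
      from : _ ≡ true → fitsAll β b ≡ true
      from p = and-allFin⁺ (fits β b) every
        where
        lo-part = ∧-l p
        rest    = ∧-r {does (size T ℕ.≟ j) ∧ independent H T} p
        hi-part = ∧-l rest
        others  = ∧-r {does (size (block c i ∖ T) ℕ.≟ lookup a i ∸ j) ∧ independent H (block c i ∖ T)} rest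
        every : ∀ p′ → fits β b p′ ≡ true
        every p′ with punchIn-cases lo p′
        ... | inj₁ ≡.refl = ≡.trans fits-lo lo-part
        ... | inj₂ (q , ≡.refl) with q Fin.≟ i
        ...   | yes ≡.refl = ≡.subst (λ z → fits β b z ≡ true) (≡.sym (punchIn-inject₁-self q)) (≡.trans fits-hi hi-part)
        ...   | no  q≢i    = ≡.trans (fits-other q q≢i) (≟-∨-elim q _ q≢i (and-allFin⁻ _ others q))

    -- Only j = |T| contributes; what remains is the T-term of χ(H|_C).
    Σ-sgn-fitsAll-splitBlock : ∀ c T → (T ⊆ᵇ block c i) ≡ true →
      Σ[ upTo (suc (lookup a i)) ] (λ j → sgn j *ₖ ⟦ fitsAll (splitEntry a i j) (splitBlock c T) ⟧)
      ≈ (⟦ othersFit c ⟧ *ₖ ⟦ does (size (block c i) ℕ.≟ lookup a i) ⟧) *ₖ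
        (sgn (size T) *ₖ ζ↾ H T *ₖ ζ↾ H (block c i ∖ T))
    Σ-sgn-fitsAll-splitBlock c T T⊆ = begin
      Σ[ upTo (suc A) ] (λ j → sgn j *ₖ ⟦ fitsAll (splitEntry a i j) (splitBlock c T) ⟧)
        ≈⟨ Σ-cong (upTo (suc A)) (λ j → *-congˡ (trans (≡⇒≈ (≡.cong ⟦_⟧ (≡.trans (fitsAll-splitBlock j c T T⊆)
                                                   (regroup (does (t ℕ.≟ j)) (independent H T) (does (size M ℕ.≟ A ∸ j))
                                                            (independent H M) (othersFit c)))))
                                                 (⟦∧⟧ _ _))) ⟩
      Σ[ upTo (suc A) ] (λ j → sgn j *ₖ (⟦ does (t ℕ.≟ j) ∧ does (size M ℕ.≟ A ∸ j) ⟧ *ₖ K))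
        ≈⟨ trans (Σ-cong (upTo (suc A)) (λ j → sym (*-assoc _ _ _))) (sym (Σ-*ʳ K (upTo (suc A)) _)) ⟩
      Σ[ upTo (suc A) ] (λ j → sgn j *ₖ ⟦ does (t ℕ.≟ j) ∧ does (size M ℕ.≟ A ∸ j) ⟧) *ₖ K
        ≈⟨ *-congʳ (Σ-sgn-split A t (size M)) ⟩
      (sgn t *ₖ ⟦ does (t + size M ℕ.≟ A) ⟧) *ₖ K
        ≈⟨ *-cong (*-congˡ (≡⇒≈ (≡.cong (λ z → ⟦ does (z ℕ.≟ A) ⟧) (size-∖ T C T⊆)))) (trans (⟦∧⟧ _ _) (*-congˡ (⟦∧⟧ _ _))) ⟩
      (sgn t *ₖ ⟦ does (size C ℕ.≟ A) ⟧) *ₖ (ζ↾ H T *ₖ (ζ↾ H M *ₖ ⟦ othersFit c ⟧))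
        ≈⟨ rearrange (sgn t) ⟦ does (size C ℕ.≟ A) ⟧ (ζ↾ H T) (ζ↾ H M) ⟦ othersFit c ⟧ ⟩
      (⟦ othersFit c ⟧ *ₖ ⟦ does (size C ℕ.≟ A) ⟧) *ₖ (sgn t *ₖ ζ↾ H T *ₖ ζ↾ H M) ∎
      where
      A = lookup a i
      C = block c i
      M = C ∖ T
      t = size T
      K = ⟦ independent H T ∧ (independent H M ∧ othersFit c) ⟧
      regroup : ∀ x d₁ y d₂ o → ((x ∧ d₁) ∧ ((y ∧ d₂) ∧ o)) ≡ ((x ∧ y) ∧ (d₁ ∧ (d₂ ∧ o)))
      regroup false d₁ y     d₂ o = ≡.refl
      regroup true  d₁ false d₂ o = Boolₚ.∧-zeroʳ d₁
      regroup true  d₁ true  d₂ o = ≡.refl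
      rearrange : ∀ s e d m o → (s *ₖ e) *ₖ (d *ₖ (m *ₖ o)) ≈ (o *ₖ e) *ₖ (s *ₖ d *ₖ m)
      rearrange = solve 5 (λ s e d m o → ((s ⊕ e) ⊕ (d ⊕ (m ⊕ o))) ⊜ ((o ⊕ e) ⊕ ((s ⊕ d) ⊕ m))) refl
        where open *-Solver using (solve; _⊕_; _⊜_)

    dehn-sommerville : Eulerian H → 1 ≤ lookup a i →
      Σ[ upTo (suc (lookup a i)) ] (λ j → sgn j *ₖ ζseq (splitEntry a i j) (n , H)) ≈ 0#
    dehn-sommerville eul 1≤A = begin
      Σ[ J ] (λ j → sgn j *ₖ Σ[ B ] (λ b → ⟦ fitsAll (splitEntry a i j) b ⟧))
        ≈⟨ Σ-cong J (λ j → Σ-*ˡ (sgn j) B _) ⟩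
      Σ[ J ] (λ j → Σ[ B ] (λ b → sgn j *ₖ ⟦ fitsAll (splitEntry a i j) b ⟧))
        ≈⟨ Σ-swap J B _ ⟩
      Σ[ B ] alternating
        ≈⟨ Σ-splitBlock i alternating ⟩
      Σ[ allAssign k n ] (λ c → Σ[ allSubsets n ] (λ T → when (T ⊆ᵇ block c i) (alternating (splitBlock c T))))
        ≈⟨ Σ-zero (allAssign k n) vanishes ⟩
      0# ∎
      where
      A = lookup a i
      J = upTo (suc A)
      B = allAssign (suc k) n
      alternating : Vec (Fin (suc k)) n → Carrier
      alternating b = Σ[ J ] (λ j → sgn j *ₖ ⟦ fitsAll (splitEntry a i j) b ⟧)
      vanishes : ∀ c → Σ[ allSubsets n ] (λ T → when (T ⊆ᵇ block c i) (alternating (splitBlock c T))) ≈ 0#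
      vanishes c = begin
        Σ[ allSubsets n ] (λ T → when (T ⊆ᵇ C) (alternating (splitBlock c T)))
          ≈⟨ Σ-cong (allSubsets n) (λ T → when-congʳ (T ⊆ᵇ C) (Σ-sgn-fitsAll-splitBlock c T)) ⟩
        Σ[ allSubsets n ] (λ T → when (T ⊆ᵇ C) (K *ₖ χ-term T))
          ≈⟨ Σ-cong (allSubsets n) (λ T → when-*ˡ (T ⊆ᵇ C) K (χ-term T)) ⟩
        Σ[ allSubsets n ] (λ T → K *ₖ when (T ⊆ᵇ C) (χ-term T))
          ≈⟨ sym (Σ-*ˡ K (allSubsets n) _) ⟩
        K *ₖ χ↾ H C
          ≈⟨ *-congˡ (Eulerian⇒χ↾≈δ₀ H eul C) ⟩
        (⟦ othersFit c ⟧ *ₖ ⟦ does (size C ℕ.≟ A) ⟧) *ₖ δ₀ (size C)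
          ≈⟨ *-assoc _ _ _ ⟩
        ⟦ othersFit c ⟧ *ₖ (⟦ does (size C ℕ.≟ A) ⟧ *ₖ δ₀ (size C))
          ≈⟨ trans (*-congˡ (⟦≟⟧*δ₀ (size C) A 1≤A)) (zeroʳ _) ⟩
        0# ∎
        where
        C = block c i
        K = ⟦ othersFit c ⟧ *ₖ ⟦ does (size C ℕ.≟ A) ⟧
        χ-term : Vec Bool n → Carrier
        χ-term T = sgn (size T) *ₖ ζ↾ H T *ₖ ζ↾ H (C ∖ T)

mainTheorem2 : ∀ {c ℓ} (F : Field c ℓ) →
    let open HopfAlg F in
    -- 𝓔(𝐇) is a subalgebra of 𝓗(𝐇) contained in S₋(𝓗(𝐇), ζ)
    (IsSubalgebra InE × (∀ x → InE x → InOdd x))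
    ×
    -- generalized Dehn–Sommerville relations
    (∀ {n} (H : Hyp n) → Eulerian H →
     ∀ {k} (a : Vec ℕ k) → (∀ i → 1 ≤ lookup a i) → sumV a ≡ n →
     ∀ (i : Fin k) →
       Σ[ upTo (suc (lookup a i)) ] (λ j → sgn j *ₖ ζseq (splitEntry a i j) (n , H)) ≈ 0#)
mainTheorem2 F =
  (InE-isSubalgebra F , InE⊆InOdd F) ,
  λ H eul a 1≤a _ i → dehn-sommerville F H a i eul (1≤a i)
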